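{- The $\mathbb F_p$-linear operators $\mathcal S,\mathcal R:\mathcal K\to\mathcal K$ defined below are $\mathcal P$-continuous, and for every $b\in\mathcal K$ one has $b=\mathcal S(b)+(\sigma-\mathrm{id})\mathcal R(b)$.
   Context: Let $p>2$ be prime and $\mathcal K$ an $N$-dimensional local field of characteristic $p$ with last residue field $k\cong\mathbb F_{p^{N_0}}$ and local parameters $t=(t_1,\dots,t_N)$, so $\mathcal K=k((t_N))\cdots((t_1))$ consists of formal series $\sum_{a\in\mathbb Z^N}\alpha_at^a$ ($\alpha_a\in k$) with support satisfying: there are integers $A_1,A_2(a_1),\dots,A_N(a_1,\dots,a_{N-1})$ with $\alpha_a\neq0\Rightarrow a_1\ge A_1,\dots,a_N\ge A_N(a_1,\dots,a_{N-1})$. The $\mathcal P$-topology on $\mathcal K$: additive-group topology with base of neighbourhoods of $0$ the sets of series with $\alpha_a=0$ whenever $a_1<B_1,a_2<B_2(a_1),\dots,a_N<B_N(a_1,\dots,a_{N-1})$, for arbitrary integer-valued $B_i$. $\mathbb Z^N$ is ordered lexicographically (first coordinate dominant), $\bar0=(0,\dots,0)$, and $\mathbb Z^+_N(p)=\{a\in\mathbb Z^N: a>\bar0,\ a\notin p\mathbb Z^N\}$. $\sigma$ is the Frobenius $x\mapsto x^p$. Fix $\alpha_0\in k$ with $\mathrm{Tr}_{k/\mathbb F_p}\alpha_0=1$. For $\alpha\in k^*$ define: if $a>\bar0$, $\mathcal S(t^a\alpha)=0$, $\mathcal R(t^a\alpha)=-\sum_{i\ge0}\sigma^i(t^a\alpha)$;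 if $a=\bar0$, $\mathcal S(\alpha)=\alpha_0\mathrm{Tr}_{k/\mathbb F_p}\alpha$, $\mathcal R(\alpha)=\sum_{0\le j<i<N_0}\sigma^j(\alpha_0)\sigma^i(\alpha)$; if $a=-a_1p^m<\bar0$ with $a_1\in\mathbb Z^+_N(p)$, $m\ge0$, $\mathcal S(t^a\alpha)=t^{ -a_1}\sigma^{ -m}\alpha$, $\mathcal R(t^a\alpha)=\sum_{1\le i\le m}\sigma^{ -i}(t^a\alpha)$. For $b=\sum_a\alpha_at^a$ set $\mathcal S(b)=\sum_a\mathcal S(\alpha_at^a)$, $\mathcal R(b)=\sum_a\mathcal R(\alpha_at^a)$. -}

module Defs where

open import Level using (Level)
open import Data.Unit using (⊤; tt)
open import Data.Empty using (⊥)
open import Data.Bool using (Bool; true; false; if_then_else_; _∧_)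
open import Data.Product using (_×_; _,_; Σ; ∃)
open import Data.Nat as ℕ using (ℕ; zero; suc)
open import Data.Nat.Divisibility using (_∣?_; divides)
open import Data.Integer as ℤ using (ℤ; +_; -[1+_]; ∣_∣)
open import Data.Fin using (Fin)
open import Data.Vec using (Vec; []; _∷_; map)
open import Relation.Nullary using (¬_; yes; no)
open import Relation.Binary.PropositionalEquality as ≡ using ()
open import Algebra.Bundles using (CommutativeRing)
open import Function.Bundles using (Inverse)

-- Exponents a ∈ ℤ^N (as vectors), and nested bound data
--   B₁ , B₂(a₁) , … , B_N(a₁,…,a_{N-1})

Exp : ℕ → Set
Exp n = Vec ℤ n

Bounds : ℕ → Set
Bounds zero    = ⊤
Bounds (suc n) = ℤ × (ℤ → Bounds n)

Above : ∀ {n} → Bounds n → Exp n → Set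
Above {zero}  _         []       = ⊤
Above {suc n} (A₁ , Af) (x ∷ xs) = (A₁ ℤ.≤ x) × Above (Af x) xs

Below : ∀ {n} → Bounds n → Exp n → Set
Below {zero}  _         []       = ⊤
Below {suc n} (B₁ , Bf) (x ∷ xs) = (x ℤ.< B₁) × Below (Bf x) xs

data Sgn : Set where
  pos zer neg : Sgn

lexSign : ∀ {n} → Exp n → Sgn
lexSign []                 = zer
lexSign (+ zero    ∷ xs)   = lexSign xs
lexSign (+ suc _   ∷ _)    = pos
lexSign (-[1+ _ ]  ∷ _)    = neg

firstAbs : ∀ {n} → Exp n → ℕ
firstAbs []              = zero
firstAbs (+ zero ∷ xs)   = firstAbs xs
firstAbs (x ∷ _)         = ∣ x ∣

cutNeg : ∀ {n} → Bounds n → Exp n → ℕ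
cutNeg {zero}  _         []            = zero
cutNeg {suc n} (A₁ , Af) (+ zero ∷ xs) = cutNeg (Af (+ zero)) xs
cutNeg {suc n} (A₁ , Af) (x ∷ xs)      = ∣ A₁ ∣

allDiv : ∀ {n} → ℕ → Exp n → Bool
allDiv d []       with d ∣? zero
... | _ = true
allDiv d (x ∷ xs) with d ∣? ∣ x ∣
... | yes _ = allDiv d xs
... | no  _ = false

-- exact quotient of an integer by d (meaningful when d ∣ x)
divZ : ℕ → ℤ → ℤ
divZ d (+ n) with d ∣? n
... | yes (divides q _) = + q
... | no  _             = + zero
divZ d -[1+ n ] with d ∣? suc n
... | yes (divides q _) = ℤ.- (+ q)
... | no  _             = + zero

divExp : ∀ {n} → ℕ → Exp n → Exp n
divExp d = map (divZ d)

scaleExp : ∀ {n} → ℕ → Exp n → Exp n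
scaleExp q = map (λ x → x ℤ.* + q)

module Field {c ℓ} (R : CommutativeRing c ℓ) where
  open CommutativeRing R

  infixr 8 _^_
  _^_ : Carrier → ℕ → Carrier
  x ^ zero  = 1#
  x ^ suc n = x * (x ^ n)

  sumTo : ℕ → (ℕ → Carrier) → Carrier
  sumTo zero    f = 0#
  sumTo (suc n) f = sumTo n f + f n

  record IsFiniteField (p N₀ : ℕ) : Set (c Level.⊔ ℓ) where
    field
      1≉0      : ¬ (1# ≈ 0#)
      inverses : ∀ x → ¬ (x ≈ 0#) → ∃ λ y → x * y ≈ 1#
      char-p   : sumTo p (λ _ → 1#) ≈ 0#
      card     : Inverse (≡.setoid (Fin (p ℕ.^ N₀))) setoid

  module Ops (p N₀ : ℕ) (α₀ : Carrier) where

    frob : ℕ → Carrier → Carrier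
    frob i x = x ^ (p ℕ.^ i)

    -- σ^{-m} on k ≅ 𝔽_{p^{N₀}}  (σ^{-1} = σ^{N₀-1})
    frobInv : ℕ → Carrier → Carrier
    frobInv m x = x ^ (p ℕ.^ ((N₀ ℕ.∸ 1) ℕ.* m))

    Tr : Carrier → Carrier
    Tr x = sumTo N₀ (λ i → frob i x)

    Rconst : Carrier → Carrier
    Rconst x = sumTo N₀ (λ i → sumTo i (λ j → frob j α₀ * frob i x))

    Series : ℕ → Set c
    Series n = Exp n → Carrier

    Supp : ∀ {n} → Bounds n → Series n → Set ℓ
    Supp A f = ∀ a → ¬ (f a ≈ 0#) → Above A a

    record 𝒦 (n : ℕ) : Set (c Level.⊔ ℓ) where
      field
        coef : Series n
        bnd  : Bounds n
        supp : Supp bnd coef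
    open 𝒦 public

    InK : ∀ {n} → Series n → Set ℓ
    InK {n} f = Σ (Bounds n) λ A → Supp A f

    -- basic 𝒫-neighbourhood of 0 determined by B
    InU : ∀ {n} → Bounds n → Series n → Set ℓ
    InU B f = ∀ a → Below B a → f a ≈ 0#

    _⊕_ : ∀ {n} → Series n → Series n → Series n
    (f ⊕ g) a = f a + g a

    _⊖_ : ∀ {n} → Series n → Series n → Series n
    (f ⊖ g) a = f a - g a

    _≋_ : ∀ {n} → Series n → Series n → Set ℓ
    f ≋ g = ∀ a → f a ≈ g a

    -- Frobenius σ on 𝒦:  Σ α_a t^a ↦ Σ α_a^p t^{pa}
    σ𝒦 : ∀ {n} → Series n → Series n
    σ𝒦 f c = if allDiv p c then frob 1 (f (divExp p c)) else 0#

    -- 𝓢(b) = Σ_a 𝓢(α_a t^a), computed coefficientwise: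
    --   c > 0̄ : 0
    --   c = 0̄ : α₀ Tr(α_0̄)
    --   c < 0̄ : 0 if c ∈ pℤ^N, else Σ_{m ≥ 0} σ^{-m}(α_{p^m c})
    --           (terms vanish for m ≥ cutNeg bnd c by the support condition)
    𝓢 : ∀ {n} → 𝒦 n → Series n
    𝓢 b c with lexSign c
    ... | pos = 0#
    ... | zer = α₀ * Tr (coef b c)
    ... | neg = if allDiv p c then 0#
                else sumTo (suc (cutNeg (bnd b) c))
                       (λ m → frobInv m (coef b (scaleExp (p ℕ.^ m) c)))

    -- 𝓡(b) = Σ_a 𝓡(α_a t^a), computed coefficientwise:
    --   c > 0̄ : - Σ_{i ≥ 0, p^i ∣ c} σ^i(α_{c/p^i})      (i ≤ |first nonzero coord|)
    --   c = 0̄ : Σ_{0 ≤ j < i < N₀} σ^j(α₀) σ^i(α_0̄)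
    --   c < 0̄ : Σ_{i ≥ 1} σ^{-i}(α_{p^i c})               (vanishing for large i)
    𝓡 : ∀ {n} → 𝒦 n → Series n
    𝓡 b c with lexSign c
    ... | pos = - sumTo (suc (firstAbs c))
                  (λ i → if allDiv (p ℕ.^ i) c
                         then frob i (coef b (divExp (p ℕ.^ i) c)) else 0#)
    ... | zer = Rconst (coef b c)
    ... | neg = sumTo (suc (cutNeg (bnd b) c))
                  (λ m → frobInv (suc m) (coef b (scaleExp (p ℕ.^ suc m) c)))

{-# OPTIONS --safe #-}

-- The t^c-coefficient of 𝓢 b and of 𝓡 b is a finite sum of Frobenius twists of the coefficients α_a
-- with a ⇝ c, where a = c if c = 0̄, a = pᵐ c if c < 0̄, and pⁱ a = c if c > 0̄; the support of b bounds
-- the number of terms.  So both operators are local and additive, which gives well-definedness and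
-- linearity, and explicit lower bounds for all exponents linked by ⇝ give membership in 𝒦 and
-- 𝒫-continuity (the bounds for continuity are support bounds after negating all exponents).
-- The identity b = 𝓢 b + (σ − id) 𝓡 b is checked coefficientwise.  For c ≠ 0̄ the sums telescope,
-- because σ sends the i-th term at c/p to the (i+1)-th term at c.  For c = 0̄ it is the identity
-- α₀ Tr y + σ(𝓡 y) − 𝓡 y = y in k, which follows from Tr α₀ = 1 and σ^N₀ = id on k.
module Submission where

open import Defs
open import Algebra.Bundles using (CommutativeRing)
open import Data.Bool using (true; false; if_then_else_)
open import Data.Bool.Properties using (⇔→≡)
open import Data.Empty using (⊥-elim)
open import Data.Fin as Fin using (Fin; toℕ)
import Data.Fin.Properties as Fin
open import Data.Fin.Permutation using (Permutation; permutation)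
open import Data.Integer as ℤ using (ℤ; +_; -[1+_]; ∣_∣; +0; +[1+_])
import Data.Integer.Properties as ℤ
open import Data.Nat as ℕ using (ℕ; zero; suc; NonZero; _≤_; _<_; _!; z≤n; s≤s)
import Data.Nat.Properties as ℕ
open import Data.Nat.Combinatorics using (_C_; nCn≡1; nCk≡n!/k![n-k]!; k![n∸k]!∣n!)
open import Data.Nat.Divisibility as ℕ using (_∣_; _∤_; _∣?_; divides)
open import Data.Nat.DivMod using (m/n*n≡m)
open import Data.Nat.Primality using (Prime; euclidsLemma; prime⇒nonTrivial; prime⇒nonZero)
open import Data.Product using (_×_; ∃; _,_; proj₁; proj₂)
open import Data.Sum using (inj₁; inj₂)
open import Data.Unit using (tt)
open import Data.Vec using ([]; _∷_; map)
open import Data.Vec.Functional using (Vector; init; last; tail; removeAt)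
open import Function using (_∘_; mk⇔)
open import Function.Bundles using (Inverse)
open import Level using (_⊔_)
open import Relation.Binary.Definitions using (Decidable)
open import Relation.Binary.PropositionalEquality as ≡ using (_≡_; _≢_)
open import Relation.Nullary using (¬_; yes; no; Dec; _×-dec_)

-- Exact division of exponent vectors

divZ-unique : ∀ d .{{_ : NonZero d}} x q → x ≡ q ℤ.* + d → divZ d x ≡ q
divZ-unique d (+ n) q eq with d ∣? n
... | yes (divides q′ n≡q′d) = ℤ.*-cancelʳ-≡ (+ q′) q (+ d) (begin
      + q′ ℤ.* + d   ≡⟨ ℤ.pos-* q′ d ⟨
      + (q′ ℕ.* d)   ≡⟨ ≡.cong +_ n≡q′d ⟨
      + n            ≡⟨ eq ⟩
      q ℤ.* + d      ∎)
  where open ≡.≡-Reasoning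
... | no d∤n = ⊥-elim (d∤n (divides ∣ q ∣ (≡.trans (≡.cong ∣_∣ eq) (ℤ.abs-* q (+ d)))))
divZ-unique d -[1+ n ] q eq with d ∣? suc n
... | yes (divides q′ n≡q′d) = ℤ.*-cancelʳ-≡ (ℤ.- + q′) q (+ d) (begin
      ℤ.- + q′ ℤ.* + d    ≡⟨ ℤ.neg-distribˡ-* (+ q′) (+ d) ⟨
      ℤ.- (+ q′ ℤ.* + d)  ≡⟨ ≡.cong ℤ.-_ (ℤ.pos-* q′ d) ⟨
      ℤ.- + (q′ ℕ.* d)    ≡⟨ ≡.cong (λ m → ℤ.- + m) n≡q′d ⟨
      -[1+ n ]            ≡⟨ eq ⟩
      q ℤ.* + d           ∎)
  where open ≡.≡-Reasoning
... | no d∤n = ⊥-elim (d∤n (divides ∣ q ∣ (≡.trans (≡.cong ∣_∣ eq) (ℤ.abs-* q (+ d)))))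

x*d/d≡x : ∀ d .{{_ : NonZero d}} x → divZ d (x ℤ.* + d) ≡ x
x*d/d≡x d x = divZ-unique d (x ℤ.* + d) x ≡.refl

x/d*d≡x : ∀ d .{{_ : NonZero d}} x → d ∣ ∣ x ∣ → divZ d x ℤ.* + d ≡ x
x/d*d≡x d x@(+ n) (divides q n≡qd) =
  ≡.trans (≡.cong (ℤ._* + d) (divZ-unique d x (+ q) x≡qd)) (≡.sym x≡qd)
  where x≡qd = ≡.trans (≡.cong +_ n≡qd) (ℤ.pos-* q d)
x/d*d≡x d x@(-[1+ n ]) (divides q n≡qd) =
  ≡.trans (≡.cong (ℤ._* + d) (divZ-unique d x (ℤ.- + q) x≡qd)) (≡.sym x≡qd)
  where x≡qd = ≡.trans (≡.cong (λ m → ℤ.- + m) n≡qd)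
                     (≡.trans (≡.cong ℤ.-_ (ℤ.pos-* q d)) (ℤ.neg-distribˡ-* (+ q) (+ d)))

allDiv-[] : ∀ d → allDiv {0} d [] ≡ true
allDiv-[] d with d ∣? zero
... | _ = ≡.refl

allDiv-scaleExp : ∀ {n} d .{{_ : NonZero d}} (a : Exp n) → allDiv d (scaleExp d a) ≡ true
allDiv-scaleExp d []      = allDiv-[] d
allDiv-scaleExp d (x ∷ a) with d ∣? ∣ x ℤ.* + d ∣
... | yes _   = allDiv-scaleExp d a
... | no d∤xd = ⊥-elim (d∤xd (divides ∣ x ∣ (ℤ.abs-* x (+ d))))

divExp-scaleExp : ∀ {n} d .{{_ : NonZero d}} (a : Exp n) → divExp d (scaleExp d a) ≡ a
divExp-scaleExp d []      = ≡.refl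
divExp-scaleExp d (x ∷ a) = ≡.cong₂ _∷_ (x*d/d≡x d x) (divExp-scaleExp d a)

scaleExp-divExp : ∀ {n} d .{{_ : NonZero d}} (c : Exp n) → allDiv d c ≡ true →
                  scaleExp d (divExp d c) ≡ c
scaleExp-divExp d []      _ = ≡.refl
scaleExp-divExp d (x ∷ c) h with d ∣? ∣ x ∣
... | yes d∣x = ≡.cong₂ _∷_ (x/d*d≡x d x d∣x) (scaleExp-divExp d c h)
... | no _    with h
...   | ()

scaleExp-injective : ∀ {n} d .{{_ : NonZero d}} {a b : Exp n} → scaleExp d a ≡ scaleExp d b → a ≡ b
scaleExp-injective d {a} {b} eq =
  ≡.trans (≡.sym (divExp-scaleExp d a)) (≡.trans (≡.cong (divExp d) eq) (divExp-scaleExp d b))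

scaleExp-1 : ∀ {n} (c : Exp n) → scaleExp 1 c ≡ c
scaleExp-1 []      = ≡.refl
scaleExp-1 (x ∷ c) = ≡.cong₂ _∷_ (ℤ.*-identityʳ x) (scaleExp-1 c)

allDiv-1 : ∀ {n} (c : Exp n) → allDiv 1 c ≡ true
allDiv-1 c = ≡.subst (λ c′ → allDiv 1 c′ ≡ true) (scaleExp-1 c) (allDiv-scaleExp 1 c)

divExp-1 : ∀ {n} (c : Exp n) → divExp 1 c ≡ c
divExp-1 c = ≡.subst (λ c′ → divExp 1 c′ ≡ c) (scaleExp-1 c) (divExp-scaleExp 1 c)

scaleExp-scaleExp : ∀ {n} d e (a : Exp n) → scaleExp d (scaleExp e a) ≡ scaleExp (d ℕ.* e) a
scaleExp-scaleExp d e []      = ≡.refl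
scaleExp-scaleExp d e (x ∷ a) = ≡.cong₂ _∷_ (begin
  x ℤ.* + e ℤ.* + d    ≡⟨ ℤ.*-assoc x (+ e) (+ d) ⟩
  x ℤ.* (+ e ℤ.* + d)  ≡⟨ ≡.cong (x ℤ.*_) (ℤ.pos-* e d) ⟨
  x ℤ.* + (e ℕ.* d)    ≡⟨ ≡.cong (λ m → x ℤ.* + m) (ℕ.*-comm e d) ⟩
  x ℤ.* + (d ℕ.* e)    ∎) (scaleExp-scaleExp d e a)
  where open ≡.≡-Reasoning

scaleExp-factor : ∀ {n} d e .{{_ : NonZero e}} (a : Exp n) → allDiv e a ≡ true →
                  scaleExp d a ≡ scaleExp (d ℕ.* e) (divExp e a)
scaleExp-factor d e a e∣a =
  ≡.trans (≡.cong (scaleExp d) (≡.sym (scaleExp-divExp e a e∣a))) (scaleExp-scaleExp d e (divExp e a))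

allDiv-*-scaleExp : ∀ {n} d e .{{_ : NonZero d}} .{{_ : NonZero e}} (a : Exp n) →
                    allDiv (d ℕ.* e) (scaleExp d a) ≡ allDiv e a
allDiv-*-scaleExp d@(suc _) e@(suc _) a = ⇔→≡ (mk⇔ de∣da⇒e∣a e∣a⇒de∣da)
  where
  de∣da⇒e∣a : allDiv (d ℕ.* e) (scaleExp d a) ≡ true → allDiv e a ≡ true
  de∣da⇒e∣a de∣da = ≡.trans (≡.cong (allDiv e) a≡ea′) (allDiv-scaleExp e a′)
    where
    a′ = divExp (d ℕ.* e) (scaleExp d a)
    a≡ea′ : a ≡ scaleExp e a′
    a≡ea′ = scaleExp-injective d (≡.trans (≡.sym (scaleExp-divExp (d ℕ.* e) (scaleExp d a) de∣da))
                                          (≡.sym (scaleExp-scaleExp d e a′)))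
  e∣a⇒de∣da : allDiv e a ≡ true → allDiv (d ℕ.* e) (scaleExp d a) ≡ true
  e∣a⇒de∣da e∣a =
    ≡.trans (≡.cong (allDiv (d ℕ.* e)) (scaleExp-factor d e a e∣a)) (allDiv-scaleExp (d ℕ.* e) (divExp e a))

divExp-*-scaleExp : ∀ {n} d e .{{_ : NonZero d}} .{{_ : NonZero e}} (a : Exp n) → allDiv e a ≡ true →
                    divExp (d ℕ.* e) (scaleExp d a) ≡ divExp e a
divExp-*-scaleExp d@(suc _) e@(suc _) a e∣a =
  ≡.trans (≡.cong (divExp (d ℕ.* e)) (scaleExp-factor d e a e∣a)) (divExp-scaleExp (d ℕ.* e) (divExp e a))

allDiv-*⇒allDiv : ∀ {n} d e .{{_ : NonZero d}} .{{_ : NonZero e}} (c : Exp n) →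
                  allDiv (d ℕ.* e) c ≡ true → allDiv d c ≡ true
allDiv-*⇒allDiv d@(suc _) e@(suc _) c de∣c = begin
  allDiv d c                            ≡⟨ ≡.cong (allDiv d) (scaleExp-divExp (d ℕ.* e) c de∣c) ⟨
  allDiv d (scaleExp (d ℕ.* e) a)       ≡⟨ ≡.cong (allDiv d) (scaleExp-scaleExp d e a) ⟨
  allDiv d (scaleExp d (scaleExp e a))  ≡⟨ allDiv-scaleExp d (scaleExp e a) ⟩
  true                                  ∎
  where
  open ≡.≡-Reasoning
  a = divExp (d ℕ.* e) c

-- Signs and sizes of exponents

lexSign-scaleExp : ∀ {n} d .{{_ : NonZero d}} (c : Exp n) → lexSign (scaleExp d c) ≡ lexSign c
lexSign-scaleExp d@(suc _) []             = ≡.refl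
lexSign-scaleExp d@(suc _) (+0 ∷ c)       = lexSign-scaleExp d c
lexSign-scaleExp d@(suc _) (+[1+ _ ] ∷ c) = ≡.refl
lexSign-scaleExp d@(suc _) (-[1+ _ ] ∷ c) = ≡.refl

lexSign-divExp : ∀ {n} d .{{_ : NonZero d}} (c : Exp n) → allDiv d c ≡ true →
                 lexSign (divExp d c) ≡ lexSign c
lexSign-divExp d c h =
  ≡.trans (≡.sym (lexSign-scaleExp d (divExp d c))) (≡.cong lexSign (scaleExp-divExp d c h))

scaleExp-zer : ∀ {n} d (c : Exp n) → lexSign c ≡ zer → scaleExp d c ≡ c
scaleExp-zer d []       _ = ≡.refl
scaleExp-zer d (+0 ∷ c) h = ≡.cong (+0 ∷_) (scaleExp-zer d c h)

allDiv-zer : ∀ {n} d .{{_ : NonZero d}} (c : Exp n) → lexSign c ≡ zer → allDiv d c ≡ true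
allDiv-zer d c c≡0 = ≡.subst (λ c′ → allDiv d c′ ≡ true) (scaleExp-zer d c c≡0) (allDiv-scaleExp d c)

divExp-zer : ∀ {n} d .{{_ : NonZero d}} (c : Exp n) → lexSign c ≡ zer → divExp d c ≡ c
divExp-zer d c c≡0 = ≡.subst (λ c′ → divExp d c′ ≡ c) (scaleExp-zer d c c≡0) (divExp-scaleExp d c)

firstAbs-scaleExp : ∀ {n} d .{{_ : NonZero d}} (c : Exp n) → firstAbs (scaleExp d c) ≡ firstAbs c ℕ.* d
firstAbs-scaleExp d@(suc _) []             = ≡.refl
firstAbs-scaleExp d@(suc _) (+0 ∷ c)       = firstAbs-scaleExp d c
firstAbs-scaleExp d@(suc _) (+[1+ _ ] ∷ c) = ≡.refl
firstAbs-scaleExp d@(suc _) (-[1+ _ ] ∷ c) = ≡.refl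

firstAbs-nonzero : ∀ {n} (c : Exp n) → lexSign c ≢ zer → 1 ≤ firstAbs c
firstAbs-nonzero []             h = ⊥-elim (h ≡.refl)
firstAbs-nonzero (+0 ∷ c)       h = firstAbs-nonzero c h
firstAbs-nonzero (+[1+ _ ] ∷ c) h = s≤s z≤n
firstAbs-nonzero (-[1+ _ ] ∷ c) h = s≤s z≤n

allDiv⇒≤firstAbs : ∀ {n} d .{{_ : NonZero d}} (c : Exp n) → lexSign c ≢ zer → allDiv d c ≡ true →
                   d ≤ firstAbs c
allDiv⇒≤firstAbs d c c≢0 h = begin
  d                          ≤⟨ ℕ.m≤n*m d (firstAbs a) {{ℕ.>-nonZero a≢0}} ⟩
  firstAbs a ℕ.* d           ≡⟨ firstAbs-scaleExp d a ⟨
  firstAbs (scaleExp d a)    ≡⟨ ≡.cong firstAbs (scaleExp-divExp d c h) ⟩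
  firstAbs c                 ∎
  where
  open ℕ.≤-Reasoning
  a = divExp d c
  a≢0 = firstAbs-nonzero a (c≢0 ∘ ≡.trans (≡.sym (lexSign-divExp d c h)))

cutNeg-scaleExp : ∀ {n} d .{{_ : NonZero d}} (A : Bounds n) (c : Exp n) →
                  cutNeg A (scaleExp d c) ≡ cutNeg A c
cutNeg-scaleExp d@(suc _) _         []             = ≡.refl
cutNeg-scaleExp d@(suc _) (_ , Af)  (+0 ∷ c)       = cutNeg-scaleExp d (Af +0) c
cutNeg-scaleExp d@(suc _) _         (+[1+ _ ] ∷ c) = ≡.refl
cutNeg-scaleExp d@(suc _) _         (-[1+ _ ] ∷ c) = ≡.refl

cutNeg-divExp : ∀ {n} d .{{_ : NonZero d}} (A : Bounds n) (c : Exp n) → allDiv d c ≡ true →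
                cutNeg A (divExp d c) ≡ cutNeg A c
cutNeg-divExp d A c h =
  ≡.trans (≡.sym (cutNeg-scaleExp d A (divExp d c))) (≡.cong (cutNeg A) (scaleExp-divExp d c h))

≤-negMultiple⇒≤∣∣ : ∀ {A} k d .{{_ : NonZero d}} → A ℤ.≤ -[1+ k ] ℤ.* + d → d ≤ ∣ A ∣
≤-negMultiple⇒≤∣∣ { -[1+ _ ]} k d@(suc t) (ℤ.-≤- le) = s≤s (ℕ.≤-trans (ℕ.m≤m+n t _) le)

posMultiple : ∀ k d .{{_ : NonZero d}} → ∃ λ K → (+[1+ k ] ℤ.* + d ≡ +[1+ K ]) × d ≤ suc K
posMultiple k d@(suc t) = t ℕ.+ k ℕ.* d , ≡.refl , s≤s (ℕ.m≤m+n t _)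

cutNeg-bound : ∀ {n} d .{{_ : NonZero d}} (A : Bounds n) (c : Exp n) → lexSign c ≡ neg →
               Above A (scaleExp d c) → d ≤ cutNeg A c
cutNeg-bound d@(suc _) (_ , Af) (+0 ∷ c)       c<0 (_ , above) = cutNeg-bound d (Af +0) c c<0 above
cutNeg-bound d@(suc _) _        (-[1+ k ] ∷ c) _   (A₁≤ , _)   = ≤-negMultiple⇒≤∣∣ k d A₁≤

negExp : ∀ {n} → Exp n → Exp n
negExp = map (ℤ.-_)

flipSgn : Sgn → Sgn
flipSgn pos = neg
flipSgn zer = zer
flipSgn neg = pos

lexSign-negExp : ∀ {n} (c : Exp n) → lexSign (negExp c) ≡ flipSgn (lexSign c)
lexSign-negExp []             = ≡.refl
lexSign-negExp (+0 ∷ c)       = lexSign-negExp c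
lexSign-negExp (+[1+ _ ] ∷ c) = ≡.refl
lexSign-negExp (-[1+ _ ] ∷ c) = ≡.refl

negExp-scaleExp : ∀ {n} d (c : Exp n) → negExp (scaleExp d c) ≡ scaleExp d (negExp c)
negExp-scaleExp d []      = ≡.refl
negExp-scaleExp d (x ∷ c) = ≡.cong₂ _∷_ (ℤ.neg-distribˡ-* x (+ d)) (negExp-scaleExp d c)

n<m^n : ∀ {m} → 1 < m → ∀ n → n < m ℕ.^ n
n<m^n     1<m zero    = s≤s z≤n
n<m^n {m} 1<m (suc n) = ℕ.≤-<-trans (n<m^n 1<m n) (ℕ.^-monoʳ-< m 1<m (ℕ.n<1+n n))

-- Neighbourhood bounds

above? : ∀ {n} (A : Bounds n) (c : Exp n) → Dec (Above A c)
above? {zero}  _         []       = yes tt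
above? {suc n} (A₁ , Af) (x ∷ c) = (A₁ ℤ.≤? x) ×-dec above? (Af x) c

infixl 7 _⊓ᴮ_
_⊓ᴮ_ : ∀ {n} → Bounds n → Bounds n → Bounds n
_⊓ᴮ_ {zero}  _         _         = tt
_⊓ᴮ_ {suc n} (A₁ , Af) (B₁ , Bf) = A₁ ℤ.⊓ B₁ , λ x → Af x ⊓ᴮ Bf x

above-⊓ᴮˡ : ∀ {n} (A B : Bounds n) {c} → Above A c → Above (A ⊓ᴮ B) c
above-⊓ᴮˡ {zero}  _         _         {[]}    _           = tt
above-⊓ᴮˡ {suc n} (A₁ , Af) (B₁ , Bf) {x ∷ c} (A₁≤x , Af≤c) =
  ℤ.i≤j⇒i⊓k≤j B₁ A₁≤x , above-⊓ᴮˡ (Af x) (Bf x) Af≤c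

above-⊓ᴮʳ : ∀ {n} (A B : Bounds n) {c} → Above B c → Above (A ⊓ᴮ B) c
above-⊓ᴮʳ {zero}  _         _         {[]}    _           = tt
above-⊓ᴮʳ {suc n} (A₁ , Af) (B₁ , Bf) {x ∷ c} (B₁≤x , Bf≤c) =
  ℤ.i≤j⇒k⊓i≤j A₁ B₁≤x , above-⊓ᴮʳ (Af x) (Bf x) Bf≤c

⨅ᴮ : ∀ {n} → (ℕ → Bounds n) → ℕ → Bounds n
⨅ᴮ F zero    = F zero
⨅ᴮ F (suc K) = ⨅ᴮ F K ⊓ᴮ F (suc K)

above-⨅ᴮ : ∀ {n} (F : ℕ → Bounds n) {i K c} → i ≤ K → Above (F i) c → Above (⨅ᴮ F K) c
above-⨅ᴮ F {K = zero}  z≤n above = above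
above-⨅ᴮ F {K = suc K} i≤K above with ℕ.m≤n⇒m<n∨m≡n i≤K
... | inj₁ (s≤s i≤K′) = above-⊓ᴮˡ (⨅ᴮ F K) (F (suc K)) (above-⨅ᴮ F i≤K′ above)
... | inj₂ ≡.refl      = above-⊓ᴮʳ (⨅ᴮ F K) (F (suc K)) above

scaleBounds : ∀ {n} → ℕ → Bounds n → Bounds n
scaleBounds {zero}  d _         = tt
scaleBounds {suc n} d (A₁ , Af) = A₁ ℤ.* + d , λ y → scaleBounds d (Af (divZ d y))

above-scaleBounds : ∀ {n} d .{{_ : NonZero d}} (A : Bounds n) {c} → Above A c →
                    Above (scaleBounds d A) (scaleExp d c)
above-scaleBounds {zero}  d _         {[]}    _ = tt
above-scaleBounds {suc n} d (A₁ , Af) {x ∷ c} (A₁≤x , Af≤c) =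
  ℤ.*-monoʳ-≤-nonNeg (+ d) A₁≤x ,
  ≡.subst (λ y → Above (scaleBounds d (Af y)) (scaleExp d c)) (≡.sym (x*d/d≡x d x))
        (above-scaleBounds d (Af x) Af≤c)

-∣i∣≤i : ∀ i → ℤ.- + ∣ i ∣ ℤ.≤ i
-∣i∣≤i (+ _)    = ℤ.neg-≤-pos
-∣i∣≤i -[1+ _ ] = ℤ.≤-refl

≤-multiple⇒-∣∣≤ : ∀ {A} x d .{{_ : NonZero d}} → A ℤ.≤ x ℤ.* + d → ℤ.- + ∣ A ∣ ℤ.≤ x
≤-multiple⇒-∣∣≤ (+ _)       d           _ = ℤ.neg-≤-pos
≤-multiple⇒-∣∣≤ {A} -[1+ k ] d@(suc t) A≤xd =
  ℤ.≤-trans (-∣i∣≤i A) (ℤ.≤-trans A≤xd (ℤ.-≤- (ℕ.≤-trans (ℕ.m≤m*n k d) (ℕ.m≤n+m _ t))))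

unscaleBounds : ∀ {n} → ℕ → Bounds n → Bounds n
unscaleBounds {zero}  d _         = tt
unscaleBounds {suc n} d (A₁ , Af) = ℤ.- + ∣ A₁ ∣ , λ y → unscaleBounds d (Af (y ℤ.* + d))

above-unscaleBounds : ∀ {n} d .{{_ : NonZero d}} (A : Bounds n) {c} → Above A (scaleExp d c) →
                      Above (unscaleBounds d A) c
above-unscaleBounds {zero}  d _         {[]}    _ = tt
above-unscaleBounds {suc n} d (A₁ , Af) {x ∷ c} (A₁≤xd , Af≤c) =
  ≤-multiple⇒-∣∣≤ x d A₁≤xd , above-unscaleBounds d (Af (x ℤ.* + d)) Af≤c

reflectBounds : ∀ {n} → Bounds n → Bounds n
reflectBounds {zero}  _         = tt
reflectBounds {suc n} (B₁ , Bf) = ℤ.suc (ℤ.- B₁) , λ x → reflectBounds (Bf (ℤ.- x))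

below⇒above-reflectBounds : ∀ {n} (B : Bounds n) {c} → Below B c → Above (reflectBounds B) (negExp c)
below⇒above-reflectBounds {zero}  _         {[]}    _ = tt
below⇒above-reflectBounds {suc n} (B₁ , Bf) {x ∷ c} (x<B₁ , Bf>c) =
  ℤ.i<j⇒suc[i]≤j (ℤ.neg-mono-< x<B₁) ,
  ≡.subst (λ y → Above (reflectBounds (Bf y)) (negExp c)) (≡.sym (ℤ.neg-involutive x))
        (below⇒above-reflectBounds (Bf x) Bf>c)

above-negExp⇒below-reflectBounds : ∀ {n} (A : Bounds n) {c} → Above A (negExp c) →
                                   Below (reflectBounds A) c
above-negExp⇒below-reflectBounds {zero}  _         {[]}    _ = tt
above-negExp⇒below-reflectBounds {suc n} (A₁ , Af) {x ∷ c} (A₁≤-x , Af≤c) =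
  ℤ.suc[i]≤j⇒i<j (ℤ.+-monoʳ-≤ (+ 1) x≤-A₁) , above-negExp⇒below-reflectBounds (Af (ℤ.- x)) Af≤c
  where
  x≤-A₁ : x ℤ.≤ ℤ.- A₁
  x≤-A₁ = ≡.subst (ℤ._≤ ℤ.- A₁) (ℤ.neg-involutive x) (ℤ.neg-mono-≤ A₁≤-x)

module PowerBounds (p : ℕ) (1<p : 1 < p) where

  instance
    p≢0 : NonZero p
    p≢0 = ℕ.>-nonZero (ℕ.<-trans (s≤s z≤n) 1<p)

  -- Not an instance: instance search cannot solve p ^ ?i = p ^ i, so it is passed explicitly.
  p^≢0 : ∀ i → NonZero (p ℕ.^ i)
  p^≢0 i = ℕ.m^n≢0 p i

  i<p^i : ∀ i → i < p ℕ.^ i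
  i<p^i = n<m^n 1<p

  -- If pᵐ c lies above A for a negative c, its first nonzero coordinate is at most −pᵐ there,
  -- so pᵐ ≤ |A₁| and only the m ≤ |A₁| need to be taken into account.
  fromNegMultiples : ∀ {n} → Bounds n → Bounds n
  fromNegMultiplesᵗ : ∀ {n} → ℤ → (ℤ → Bounds n) → ℤ → Bounds n
  fromNegMultiples {zero}  _         = tt
  fromNegMultiples {suc n} (A₁ , Af) = ℤ.- + ∣ A₁ ∣ , fromNegMultiplesᵗ A₁ Af
  fromNegMultiplesᵗ A₁ Af +0           = fromNegMultiples (Af +0)
  fromNegMultiplesᵗ A₁ Af y@(+[1+ _ ]) = Af y
  fromNegMultiplesᵗ A₁ Af y@(-[1+ _ ]) =
    ⨅ᴮ (λ m → unscaleBounds (p ℕ.^ m) (Af (y ℤ.* + (p ℕ.^ m)))) ∣ A₁ ∣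

  above-fromNegMultiples : ∀ {n} (A : Bounds n) (c : Exp n) m → lexSign c ≡ neg →
                           Above A (scaleExp (p ℕ.^ m) c) → Above (fromNegMultiples A) c
  above-fromNegMultiples (A₁ , Af) (+0 ∷ c) m c<0 (_ , Af≤c) =
    ℤ.neg-≤-pos , above-fromNegMultiples (Af +0) c m c<0 Af≤c
  above-fromNegMultiples (A₁ , Af) (-[1+ k ] ∷ c) m _ (A₁≤ , Af≤c) =
    ≤-multiple⇒-∣∣≤ -[1+ k ] (p ℕ.^ m) {{p^≢0 m}} A₁≤ ,
    above-⨅ᴮ _ (ℕ.<⇒≤ (ℕ.<-≤-trans (i<p^i m) (≤-negMultiple⇒≤∣∣ k (p ℕ.^ m) {{p^≢0 m}} A₁≤)))
             (above-unscaleBounds (p ℕ.^ m) {{p^≢0 m}} (Af _) Af≤c)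

  -- The first nonzero coordinate y of pⁱ a, for a positive a, is a positive multiple of pⁱ,
  -- so only the i ≤ |y| need to be taken into account.
  toPosMultiples : ∀ {n} → Bounds n → Bounds n
  toPosMultiplesᵗ : ∀ {n} → (ℤ → Bounds n) → ℤ → Bounds n
  toPosMultiples {zero}  _        = tt
  toPosMultiples {suc n} (_ , Af) = +0 , toPosMultiplesᵗ Af
  toPosMultiplesᵗ Af +0           = toPosMultiples (Af +0)
  toPosMultiplesᵗ Af y@(+[1+ _ ]) = ⨅ᴮ (λ i → scaleBounds (p ℕ.^ i) (Af (divZ (p ℕ.^ i) y))) ∣ y ∣
  toPosMultiplesᵗ Af y@(-[1+ _ ]) = Af y

  above-toPosMultiples : ∀ {n} (A : Bounds n) (a : Exp n) i → lexSign a ≡ pos → Above A a →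
                         Above (toPosMultiples A) (scaleExp (p ℕ.^ i) a)
  above-toPosMultiples (_ , Af) (+0 ∷ a) i a>0 (_ , Af≤a) =
    ℤ.≤-refl , above-toPosMultiples (Af +0) a i a>0 Af≤a
  above-toPosMultiples (_ , Af) (+[1+ k ] ∷ a) i _ (_ , Af≤a)
    with K , y≡ , p^i≤ ← posMultiple k (p ℕ.^ i) {{p^≢0 i}} =
    ≡.subst (λ y → (+0 ℤ.≤ y) × Above (toPosMultiplesᵗ Af y) (scaleExp (p ℕ.^ i) a)) (≡.sym y≡)
      ( ℤ.+≤+ z≤n
      , above-⨅ᴮ _ (ℕ.<⇒≤ (ℕ.<-≤-trans (i<p^i i) p^i≤))
          (≡.subst (λ y → Above (scaleBounds (p ℕ.^ i) (Af y)) (scaleExp (p ℕ.^ i) a))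
                 (≡.trans (≡.sym (x*d/d≡x (p ℕ.^ i) {{p^≢0 i}} +[1+ k ])) (≡.cong (divZ (p ℕ.^ i)) y≡))
                 (above-scaleBounds (p ℕ.^ i) {{p^≢0 i}} (Af +[1+ k ]) Af≤a)))

  -- a ⇝ c: the coefficient of t^a enters the t^c-coefficients of 𝓢 b and 𝓡 b.
  infix 4 _⇝_
  data _⇝_ {n} : Exp n → Exp n → Set where
    ⇝-zer : ∀ {c} → lexSign c ≡ zer → c ⇝ c
    ⇝-neg : ∀ {c} → lexSign c ≡ neg → ∀ m → scaleExp (p ℕ.^ m) c ⇝ c
    ⇝-pos : ∀ {a} → lexSign a ≡ pos → ∀ i → a ⇝ scaleExp (p ℕ.^ i) a

  ⇝-negExp : ∀ {n} {a c : Exp n} → a ⇝ c → negExp c ⇝ negExp a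
  ⇝-negExp {c = c} (⇝-zer c≡0) = ⇝-zer (≡.trans (lexSign-negExp c) (≡.cong flipSgn c≡0))
  ⇝-negExp {c = c} (⇝-neg c<0 m) =
    ≡.subst (negExp c ⇝_) (≡.sym (negExp-scaleExp (p ℕ.^ m) c))
          (⇝-pos (≡.trans (lexSign-negExp c) (≡.cong flipSgn c<0)) m)
  ⇝-negExp {a = a} (⇝-pos a>0 i) =
    ≡.subst (_⇝ negExp a) (≡.sym (negExp-scaleExp (p ℕ.^ i) a))
          (⇝-neg (≡.trans (lexSign-negExp a) (≡.cong flipSgn a>0)) i)

  supportBounds : ∀ {n} → Bounds n → Bounds n
  supportBounds A = A ⊓ᴮ fromNegMultiples A ⊓ᴮ toPosMultiples A

  above-supportBounds : ∀ {n} (A : Bounds n) {a c} → a ⇝ c → Above A a → Above (supportBounds A) c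
  above-supportBounds A (⇝-zer _) A≤a =
    above-⊓ᴮˡ _ (toPosMultiples A) (above-⊓ᴮˡ A (fromNegMultiples A) A≤a)
  above-supportBounds A {c = c} (⇝-neg c<0 m) A≤a =
    above-⊓ᴮˡ _ (toPosMultiples A) (above-⊓ᴮʳ A (fromNegMultiples A) (above-fromNegMultiples A c m c<0 A≤a))
  above-supportBounds A {a = a} (⇝-pos a>0 i) A≤a =
    above-⊓ᴮʳ (A ⊓ᴮ fromNegMultiples A) (toPosMultiples A) (above-toPosMultiples A a i a>0 A≤a)

  -- Below B c says that −c lies above reflectBounds B, and ⇝ is reversed by negation, so the bounds
  -- needed for continuity are support bounds of the reflected neighbourhood.
  continuityBounds : ∀ {n} → Bounds n → Bounds n
  continuityBounds B = reflectBounds (supportBounds (reflectBounds B))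

  below-continuityBounds : ∀ {n} (B : Bounds n) {a c} → a ⇝ c → Below B c → Below (continuityBounds B) a
  below-continuityBounds B a⇝c c<B =
    above-negExp⇒below-reflectBounds (supportBounds (reflectBounds B))
      (above-supportBounds (reflectBounds B) (⇝-negExp a⇝c) (below⇒above-reflectBounds B c<B))

module RingSums {c ℓ} (R : CommutativeRing c ℓ) where
  open CommutativeRing R
  open Field R using (sumTo)
  open import Relation.Binary.Reasoning.Setoid setoid
  open import Algebra.Properties.AbelianGroup +-abelianGroup using (⁻¹-∙-comm; ⁻¹-anti-homo‿-)
  open import Algebra.Properties.Group +-group using (ε⁻¹≈ε)
  open import Algebra.Solver.CommutativeMonoid +-commutativeMonoid using (solve; _⊜_; _⊕_)

  -‿distrib-+ : ∀ a b → - (a + b) ≈ - a - b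
  -‿distrib-+ a b = sym (⁻¹-∙-comm a b)

  a+b≈c+d⇒a-d≈c-b : ∀ {a b c d} → a + b ≈ c + d → a - d ≈ c - b
  a+b≈c+d⇒a-d≈c-b {a} {b} {c} {d} a+b≈c+d = begin
    a - d                ≈⟨ +-identityʳ (a - d) ⟨
    (a - d) + 0#         ≈⟨ +-congˡ (-‿inverseʳ b) ⟨
    (a - d) + (b - b)    ≈⟨ solve 4 (λ a b -d -b → (a ⊕ -d) ⊕ (b ⊕ -b) ⊜ (a ⊕ b) ⊕ (-d ⊕ -b)) refl a b (- d) (- b) ⟩
    (a + b) + (- d - b)  ≈⟨ +-congʳ a+b≈c+d ⟩
    (c + d) + (- d - b)  ≈⟨ solve 4 (λ c d -d -b → (c ⊕ d) ⊕ (-d ⊕ -b) ⊜ (c ⊕ -b) ⊕ (d ⊕ -d)) refl c d (- d) (- b) ⟩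
    (c - b) + (d - d)    ≈⟨ +-congˡ (-‿inverseʳ d) ⟩
    (c - b) + 0#         ≈⟨ +-identityʳ (c - b) ⟩
    c - b                ∎

  sumTo-cong : ∀ n {f g : ℕ → Carrier} → (∀ i → f i ≈ g i) → sumTo n f ≈ sumTo n g
  sumTo-cong zero    f≈g = refl
  sumTo-cong (suc n) f≈g = +-cong (sumTo-cong n f≈g) (f≈g n)

  sumTo-0 : ∀ n → sumTo n (λ _ → 0#) ≈ 0#
  sumTo-0 zero    = refl
  sumTo-0 (suc n) = trans (+-identityʳ _) (sumTo-0 n)

  sumTo-+ : ∀ n (f g : ℕ → Carrier) → sumTo n (λ i → f i + g i) ≈ sumTo n f + sumTo n g
  sumTo-+ zero    f g = sym (+-identityʳ 0#)
  sumTo-+ (suc n) f g = begin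
    sumTo n (λ i → f i + g i) + (f n + g n)  ≈⟨ +-congʳ (sumTo-+ n f g) ⟩
    (sumTo n f + sumTo n g) + (f n + g n)
      ≈⟨ solve 4 (λ a b c d → (a ⊕ b) ⊕ (c ⊕ d) ⊜ (a ⊕ c) ⊕ (b ⊕ d)) refl (sumTo n f) (sumTo n g) (f n) (g n) ⟩
    (sumTo n f + f n) + (sumTo n g + g n)    ∎

  sumTo-‿ : ∀ n (f : ℕ → Carrier) → sumTo n (λ i → - f i) ≈ - sumTo n f
  sumTo-‿ zero    f = sym ε⁻¹≈ε
  sumTo-‿ (suc n) f = trans (+-congʳ (sumTo-‿ n f)) (sym (-‿distrib-+ (sumTo n f) (f n)))

  sumTo-*ʳ : ∀ n (f : ℕ → Carrier) y → sumTo n (λ i → f i * y) ≈ sumTo n f * y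
  sumTo-*ʳ zero    f y = sym (zeroˡ y)
  sumTo-*ʳ (suc n) f y = trans (+-congʳ (sumTo-*ʳ n f y)) (sym (distribʳ y (sumTo n f) (f n)))

  sumTo-*ˡ : ∀ n (f : ℕ → Carrier) y → sumTo n (λ i → y * f i) ≈ y * sumTo n f
  sumTo-*ˡ n f y = trans (sumTo-cong n (λ i → *-comm y (f i))) (trans (sumTo-*ʳ n f y) (*-comm _ y))

  sumTo-suc : ∀ n (f : ℕ → Carrier) → sumTo (suc n) f ≈ f 0 + sumTo n (λ i → f (suc i))
  sumTo-suc zero    f = trans (+-identityˡ (f 0)) (sym (+-identityʳ (f 0)))
  sumTo-suc (suc n) f = trans (+-congʳ (sumTo-suc n f)) (+-assoc (f 0) _ _)

  sumTo-telescope : ∀ n (f : ℕ → Carrier) → sumTo n f - sumTo n (λ i → f (suc i)) ≈ f 0 - f n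
  sumTo-telescope n f = a+b≈c+d⇒a-d≈c-b (sumTo-suc n f)

  VanishesFrom : ℕ → (ℕ → Carrier) → Set ℓ
  VanishesFrom k f = ∀ i → k ≤ i → f i ≈ 0#

  sumTo-vanishesFrom : ∀ {k L f} → k ≤ L → VanishesFrom k f → sumTo L f ≈ sumTo k f
  sumTo-vanishesFrom {k} {L} k≤L f≈0 with ℕ.m≤n⇒m<n∨m≡n k≤L
  ... | inj₂ ≡.refl = refl
  sumTo-vanishesFrom {L = suc L} _ f≈0 | inj₁ (s≤s k≤L) =
    trans (+-cong (sumTo-vanishesFrom k≤L f≈0) (f≈0 L k≤L)) (+-identityʳ _)

  sumTo-+-vanishing : ∀ {k k′ k″ f g h} → VanishesFrom k f → VanishesFrom k′ g → VanishesFrom k″ h →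
                      (∀ i → h i ≈ f i + g i) → sumTo k″ h ≈ sumTo k f + sumTo k′ g
  sumTo-+-vanishing {k} {k′} {k″} {f} {g} {h} f≈0 g≈0 h≈0 h≈f+g = begin
    sumTo k″ h                 ≈⟨ sumTo-vanishesFrom (ℕ.m≤n+m k″ (k ℕ.+ k′)) h≈0 ⟨
    sumTo L h                  ≈⟨ sumTo-cong L h≈f+g ⟩
    sumTo L (λ i → f i + g i)  ≈⟨ sumTo-+ L f g ⟩
    sumTo L f + sumTo L g      ≈⟨ +-cong (sumTo-vanishesFrom (ℕ.≤-trans (ℕ.m≤m+n k k′) (ℕ.m≤m+n _ k″)) f≈0)
                                         (sumTo-vanishesFrom (ℕ.≤-trans (ℕ.m≤n+m k′ k) (ℕ.m≤m+n _ k″)) g≈0) ⟩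
    sumTo k f + sumTo k′ g     ∎
    where L = k ℕ.+ k′ ℕ.+ k″

  sumTo-cong-vanishing : ∀ {k k′ f g} → VanishesFrom k f → VanishesFrom k′ g →
                         (∀ i → f i ≈ g i) → sumTo k f ≈ sumTo k′ g
  sumTo-cong-vanishing {k} {k′} {f} {g} f≈0 g≈0 f≈g = begin
    sumTo k f            ≈⟨ sumTo-vanishesFrom (ℕ.m≤m+n k k′) f≈0 ⟨
    sumTo (k ℕ.+ k′) f   ≈⟨ sumTo-cong (k ℕ.+ k′) f≈g ⟩
    sumTo (k ℕ.+ k′) g   ≈⟨ sumTo-vanishesFrom (ℕ.m≤n+m k′ k) g≈0 ⟩
    sumTo k′ g           ∎

  [-x]-[-y]≈y-x : ∀ x y → - x - - y ≈ y - x
  [-x]-[-y]≈y-x x y = trans (⁻¹-∙-comm x (- y)) (⁻¹-anti-homo‿- x y)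

  x-0≈x : ∀ x → x - 0# ≈ x
  x-0≈x x = trans (+-congˡ ε⁻¹≈ε) (+-identityʳ x)

p∤m! : ∀ {p m} → Prime p → m < p → p ∤ m !
p∤m! {m = zero}  p-prime _   p∣1   = ℕ.nonTrivial⇒≢1 {{prime⇒nonTrivial p-prime}} (ℕ.∣1⇒≡1 p∣1)
p∤m! {m = suc m} p-prime m<p p∣m! with euclidsLemma (suc m) (m !) p-prime p∣m!
... | inj₁ p∣m = ℕ.<-irrefl ≡.refl (ℕ.≤-<-trans (ℕ.∣⇒≤ p∣m) m<p)
... | inj₂ p∣m! = p∤m! p-prime (ℕ.<-trans (ℕ.n<1+n m) m<p) p∣m!

n∣n! : ∀ {n} → 0 < n → n ∣ n !
n∣n! {suc m} _ = ℕ.m∣m*n (m !)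

p∣pCk : ∀ {p k} → Prime p → 0 < k → k < p → p ∣ p C k
p∣pCk {p} {k} p-prime 0<k k<p with euclidsLemma (p C k) (k ! ℕ.* (p ℕ.∸ k) !) p-prime p∣pCk*k![p-k]!
  where
  instance _ = k ℕ.!* (p ℕ.∸ k) !≢0
  p∣pCk*k![p-k]! : p ∣ (p C k) ℕ.* (k ! ℕ.* (p ℕ.∸ k) !)
  p∣pCk*k![p-k]! = ≡.subst (p ∣_) (≡.sym pCk*k![p-k]!≡p!) (n∣n! (ℕ.<-trans 0<k k<p))
    where
    pCk*k![p-k]!≡p! : (p C k) ℕ.* (k ! ℕ.* (p ℕ.∸ k) !) ≡ p !
    pCk*k![p-k]!≡p! = ≡.trans (≡.cong (ℕ._* (k ! ℕ.* (p ℕ.∸ k) !)) (nCk≡n!/k![n-k]! (ℕ.<⇒≤ k<p)))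
                              (m/n*n≡m (k![n∸k]!∣n! (ℕ.<⇒≤ k<p)))
... | inj₁ p∣pCk = p∣pCk
... | inj₂ p∣k![p-k]! with euclidsLemma (k !) ((p ℕ.∸ k) !) p-prime p∣k![p-k]!
...   | inj₁ p∣k! = ⊥-elim (p∤m! p-prime k<p p∣k!)
...   | inj₂ p∣[p-k]! = ⊥-elim (p∤m! p-prime (ℕ.∸-monoʳ-< 0<k (ℕ.<⇒≤ k<p)) p∣[p-k]!)

module Characteristic {c ℓ} (R : CommutativeRing c ℓ) {p : ℕ} (p-prime : Prime p)
  (char-p : CommutativeRing._≈_ R (Field.sumTo R p (λ _ → CommutativeRing.1# R)) (CommutativeRing.0# R)) where
  open CommutativeRing R
  open Field R using (sumTo)
  open import Algebra.Properties.Semiring.Exp semiring using (_^_; ^-congˡ; ^-assocʳ)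
  import Algebra.Properties.Semiring.Mult semiring as Mult
  open Mult using (×-assoc-*; ×1-homo-*)
  open import Algebra.Properties.Monoid.Sum +-monoid using (sum; sum-init-last; sum-cong-≋; sum-replicate-zero)
  open import Algebra.Properties.Group +-group using (inverseʳ-unique)
  import Algebra.Properties.CommutativeSemiring.Binomial commutativeSemiring as Binomial
  open import Relation.Binary.Reasoning.Setoid setoid

  ×1≈sumTo : ∀ n → n Mult.× 1# ≈ sumTo n (λ _ → 1#)
  ×1≈sumTo zero    = refl
  ×1≈sumTo (suc n) = trans (+-comm 1# (n Mult.× 1#)) (+-congʳ (×1≈sumTo n))

  p∣n⇒n×x≈0 : ∀ {n} x → p ∣ n → n Mult.× x ≈ 0#
  p∣n⇒n×x≈0 {n} x (divides q n≡qp) = begin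
    n Mult.× x                               ≈⟨ ×-congʳ n (*-identityˡ x) ⟨
    n Mult.× (1# * x)                        ≈⟨ ×-assoc-* n 1# x ⟨
    (n Mult.× 1#) * x                        ≡⟨ ≡.cong (λ m → (m Mult.× 1#) * x) n≡qp ⟩
    ((q ℕ.* p) Mult.× 1#) * x                ≈⟨ *-congʳ (×1-homo-* q p) ⟩
    ((q Mult.× 1#) * (p Mult.× 1#)) * x      ≈⟨ *-congʳ (*-congˡ (trans (×1≈sumTo p) char-p)) ⟩
    ((q Mult.× 1#) * 0#) * x                 ≈⟨ *-congʳ (zeroʳ (q Mult.× 1#)) ⟩
    0# * x                                   ≈⟨ zeroˡ x ⟩
    0#                                       ∎
    where open import Algebra.Properties.Monoid.Mult +-monoid using (×-congʳ)

  binomialExpansion-extremes : ∀ x y m .{{_ : ℕ.NonZero m}} →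
    (∀ (k : Fin (suc m)) → 0 < toℕ k → toℕ k < m → Binomial.binomialTerm x y m k ≈ 0#) →
    Binomial.binomialExpansion x y m ≈ x ^ m + y ^ m
  binomialExpansion-extremes x y (suc n) middle≈0 = begin
    t Fin.zero + sum (tail t)                             ≈⟨ +-congˡ (sum-init-last (tail t)) ⟩
    t Fin.zero + (sum (init (tail t)) + last (tail t))    ≈⟨ +-cong t₀≈yⁿ (+-cong inner≈0 tₙ≈xⁿ) ⟩
    y ^ suc n + (0# + x ^ suc n)                          ≈⟨ +-congˡ (+-identityˡ _) ⟩
    y ^ suc n + x ^ suc n                                 ≈⟨ +-comm _ _ ⟩
    x ^ suc n + y ^ suc n                                 ∎
    where
    t = Binomial.binomialTerm x y (suc n)
    t₀≈yⁿ : t Fin.zero ≈ y ^ suc n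
    t₀≈yⁿ = trans (+-identityʳ _) (*-identityˡ _)
    inner≈0 : sum (init (tail t)) ≈ 0#
    inner≈0 = trans (sum-cong-≋ (λ i → middle≈0 (Fin.suc (Fin.inject₁ i)) (s≤s z≤n)
                      (s≤s (≡.subst (ℕ._< n) (≡.sym (Fin.toℕ-inject₁ i)) (Fin.toℕ<n i)))))
                    (sum-replicate-zero n)
    tₙ≈xⁿ : last (tail t) ≈ x ^ suc n
    tₙ≈xⁿ = begin
      (suc n C suc (toℕ (Fin.fromℕ n))) Mult.× (x ^ suc (toℕ (Fin.fromℕ n)) * y ^ (n ℕ.∸ toℕ (Fin.fromℕ n)))
        ≡⟨ ≡.cong (λ j → (suc n C suc j) Mult.× (x ^ suc j * y ^ (n ℕ.∸ j))) (Fin.toℕ-fromℕ n) ⟩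
      (suc n C suc n) Mult.× (x ^ suc n * y ^ (n ℕ.∸ n))
        ≡⟨ ≡.cong₂ (λ a b → a Mult.× (x ^ suc n * y ^ b)) (nCn≡1 (suc n)) (ℕ.n∸n≡0 n) ⟩
      1 Mult.× (x ^ suc n * 1#)
        ≈⟨ trans (+-identityʳ _) (*-identityʳ _) ⟩
      x ^ suc n
        ∎

  ^p-+ : ∀ x y → (x + y) ^ p ≈ x ^ p + y ^ p
  ^p-+ x y = trans (Binomial.theorem p x y) (binomialExpansion-extremes x y p {{prime⇒nonZero p-prime}}
                     (λ k 0<k k<p → p∣n⇒n×x≈0 _ (p∣pCk p-prime 0<k k<p)))

  ^p^i-+ : ∀ i x y → (x + y) ^ (p ℕ.^ i) ≈ x ^ (p ℕ.^ i) + y ^ (p ℕ.^ i)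
  ^p^i-+ zero    x y = trans (*-identityʳ (x + y)) (sym (+-cong (*-identityʳ x) (*-identityʳ y)))
  ^p^i-+ (suc i) x y = begin
    (x + y) ^ (p ℕ.* p ℕ.^ i)                   ≈⟨ ^-assocʳ (x + y) p (p ℕ.^ i) ⟨
    ((x + y) ^ p) ^ (p ℕ.^ i)                   ≈⟨ ^-congˡ (p ℕ.^ i) (^p-+ x y) ⟩
    (x ^ p + y ^ p) ^ (p ℕ.^ i)                 ≈⟨ ^p^i-+ i (x ^ p) (y ^ p) ⟩
    (x ^ p) ^ (p ℕ.^ i) + (y ^ p) ^ (p ℕ.^ i)   ≈⟨ +-cong (^-assocʳ x p (p ℕ.^ i)) (^-assocʳ y p (p ℕ.^ i)) ⟩
    x ^ (p ℕ.* p ℕ.^ i) + y ^ (p ℕ.* p ℕ.^ i)   ∎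

  0^n≈0 : ∀ n .{{_ : ℕ.NonZero n}} → 0# ^ n ≈ 0#
  0^n≈0 (suc n) = zeroˡ (0# ^ n)

  0^p^i≈0 : ∀ i → 0# ^ (p ℕ.^ i) ≈ 0#
  0^p^i≈0 i = 0^n≈0 (p ℕ.^ i) {{ℕ.m^n≢0 p i {{prime⇒nonZero p-prime}}}}

  ^p^i-‿ : ∀ i x → (- x) ^ (p ℕ.^ i) ≈ - (x ^ (p ℕ.^ i))
  ^p^i-‿ i x = inverseʳ-unique (x ^ (p ℕ.^ i)) ((- x) ^ (p ℕ.^ i)) (begin
    x ^ (p ℕ.^ i) + (- x) ^ (p ℕ.^ i)  ≈⟨ ^p^i-+ i x (- x) ⟨
    (x - x) ^ (p ℕ.^ i)                ≈⟨ ^-congˡ (p ℕ.^ i) (-‿inverseʳ x) ⟩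
    0# ^ (p ℕ.^ i)                     ≈⟨ 0^p^i≈0 i ⟩
    0#                                 ∎)

module FiniteField {c ℓ} (R : CommutativeRing c ℓ) {p N₀ : ℕ} (FF : Field.IsFiniteField R p N₀) where
  open CommutativeRing R
  open Field.IsFiniteField FF
  open import Algebra.Properties.Semiring.Exp semiring using (_^_; ^-congˡ)
  open import Algebra.Properties.CommutativeMonoid.Sum *-commutativeMonoid
    using (sum-remove; ∑-distrib-+; sum-permute) renaming (sum to product)
  open import Algebra.Properties.Monoid.Sum *-monoid using (sum-cong-≋; sum-replicate)
  open import Relation.Binary.Reasoning.Setoid setoid

  infix 4 _≟_
  _≟_ : Decidable _≈_
  x ≟ y with Inverse.from card x Fin.≟ Inverse.from card y
  ... | yes fx≡fy = yes (begin
    x                                      ≈⟨ Inverse.inverseˡ card ≡.refl ⟨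
    Inverse.to card (Inverse.from card x)  ≡⟨ ≡.cong (Inverse.to card) fx≡fy ⟩
    Inverse.to card (Inverse.from card y)  ≈⟨ Inverse.inverseˡ card ≡.refl ⟩
    y                                      ∎)
  ... | no fx≢fy = no (fx≢fy ∘ Inverse.from-cong card)

  *-cancelˡ-≈0 : ∀ {a b} → ¬ (a ≈ 0#) → a * b ≈ 0# → b ≈ 0#
  *-cancelˡ-≈0 {a} {b} a≉0 ab≈0 with a⁻¹ , aa⁻¹≈1 ← inverses a a≉0 = begin
    b               ≈⟨ *-identityˡ b ⟨
    1# * b          ≈⟨ *-congʳ (trans (*-comm a⁻¹ a) aa⁻¹≈1) ⟨
    (a⁻¹ * a) * b   ≈⟨ *-assoc a⁻¹ a b ⟩
    a⁻¹ * (a * b)   ≈⟨ *-congˡ ab≈0 ⟩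
    a⁻¹ * 0#        ≈⟨ zeroʳ a⁻¹ ⟩
    0#              ∎

  product-≉0 : ∀ {n} (t : Vector Carrier n) → (∀ i → ¬ (t i ≈ 0#)) → ¬ (product t ≈ 0#)
  product-≉0 {zero}  t t≉0 = 1≉0
  product-≉0 {suc n} t t≉0 = product-≉0 (tail t) (t≉0 ∘ Fin.suc) ∘ *-cancelˡ-≈0 (t≉0 Fin.zero)

  identityˡ-unique-≉0 : ∀ {x c} → ¬ (c ≈ 0#) → x * c ≈ c → x ≈ 1#
  identityˡ-unique-≉0 {x} {c} c≉0 xc≈c with c⁻¹ , cc⁻¹≈1 ← inverses c c≉0 = begin
    x               ≈⟨ *-identityʳ x ⟨
    x * 1#          ≈⟨ *-congˡ cc⁻¹≈1 ⟨
    x * (c * c⁻¹)   ≈⟨ *-assoc x c c⁻¹ ⟨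
    (x * c) * c⁻¹   ≈⟨ *-congʳ xc≈c ⟩
    c * c⁻¹         ≈⟨ cc⁻¹≈1 ⟩
    1#              ∎

  -- Multiplication by x ≉ 0 permutes k; comparing the product of nonzeroOr1 over k with the same
  -- product over x k shows xⁿ ≈ 1, where n + 1 = |k|.
  module _ {n} (enum : Inverse (≡.setoid (Fin (suc n))) setoid) where
    private
      module E = Inverse enum

    nonzeroOr1 : Carrier → Carrier
    nonzeroOr1 y with y ≟ 0#
    ... | yes _ = 1#
    ... | no  _ = y

    nonzeroOr1-cong : ∀ {y y′} → y ≈ y′ → nonzeroOr1 y ≈ nonzeroOr1 y′
    nonzeroOr1-cong {y} {y′} y≈y′ with y ≟ 0# | y′ ≟ 0#
    ... | yes _   | yes _    = refl
    ... | yes y≈0 | no y′≉0  = ⊥-elim (y′≉0 (trans (sym y≈y′) y≈0))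
    ... | no y≉0  | yes y′≈0 = ⊥-elim (y≉0 (trans y≈y′ y′≈0))
    ... | no _    | no _     = y≈y′

    nonzeroOr1-≉0 : ∀ y → ¬ (nonzeroOr1 y ≈ 0#)
    nonzeroOr1-≉0 y with y ≟ 0#
    ... | yes _   = 1≉0
    ... | no  y≉0 = y≉0

    module _ (x : Carrier) (x≉0 : ¬ (x ≈ 0#)) where
      private
        x⁻¹ = proj₁ (inverses x x≉0)
        xx⁻¹≈1 = proj₂ (inverses x x≉0)

      xIfNonzero : Carrier → Carrier
      xIfNonzero y with y ≟ 0#
      ... | yes _ = 1#
      ... | no  _ = x

      nonzeroOr1-* : ∀ y → nonzeroOr1 (x * y) ≈ xIfNonzero y * nonzeroOr1 y
      nonzeroOr1-* y with y ≟ 0# | x * y ≟ 0#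
      ... | yes _   | yes _     = sym (*-identityˡ 1#)
      ... | yes y≈0 | no xy≉0   = ⊥-elim (xy≉0 (trans (*-congˡ y≈0) (zeroʳ x)))
      ... | no y≉0  | yes xy≈0  = ⊥-elim (y≉0 (*-cancelˡ-≈0 x≉0 xy≈0))
      ... | no _    | no _      = refl

      x*-permutation : Permutation (suc n) (suc n)
      x*-permutation = permutation (λ i → E.from (x * E.to i)) (λ j → E.from (x⁻¹ * E.to j))
                                   (cancel x x⁻¹ xx⁻¹≈1) (cancel x⁻¹ x (trans (*-comm x⁻¹ x) xx⁻¹≈1))
        where
        cancel : ∀ a b → a * b ≈ 1# → ∀ j → E.from (a * E.to (E.from (b * E.to j))) ≡ j
        cancel a b ab≈1 j = ≡.trans (E.from-cong (begin
          a * E.to (E.from (b * E.to j))  ≈⟨ *-congˡ (E.inverseˡ ≡.refl) ⟩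
          a * (b * E.to j)                ≈⟨ *-assoc a b (E.to j) ⟨
          (a * b) * E.to j                ≈⟨ *-congʳ ab≈1 ⟩
          1# * E.to j                     ≈⟨ *-identityˡ (E.to j) ⟩
          E.to j                          ∎)) (E.inverseʳ refl)

      product-xIfNonzero : product (xIfNonzero ∘ E.to) ≈ x ^ n
      product-xIfNonzero = begin
        product (xIfNonzero ∘ E.to)
          ≈⟨ sum-remove {i = E.from 0#} (xIfNonzero ∘ E.to) ⟩
        xIfNonzero (E.to (E.from 0#)) * product (removeAt (xIfNonzero ∘ E.to) (E.from 0#))
          ≈⟨ *-cong at0 (trans (sum-cong-≋ elsewhere) (sum-replicate n)) ⟩
        1# * x ^ n
          ≈⟨ *-identityˡ (x ^ n) ⟩
        x ^ n
          ∎
        where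
        at0 : xIfNonzero (E.to (E.from 0#)) ≈ 1#
        at0 with E.to (E.from 0#) ≟ 0#
        ... | yes _    = refl
        ... | no  e0≉0 = ⊥-elim (e0≉0 (E.inverseˡ ≡.refl))
        elsewhere : ∀ j → xIfNonzero (E.to (Fin.punchIn (E.from 0#) j)) ≈ x
        elsewhere j with E.to (Fin.punchIn (E.from 0#) j) ≟ 0#
        ... | no  _   = refl
        ... | yes e≈0 = ⊥-elim (Fin.punchInᵢ≢i (E.from 0#) j (≡.trans (≡.sym (E.inverseʳ refl)) (E.from-cong e≈0)))

      x^n≈1 : x ^ n ≈ 1#
      x^n≈1 = identityˡ-unique-≉0 (product-≉0 (nonzeroOr1 ∘ E.to) (nonzeroOr1-≉0 ∘ E.to)) (begin
        x ^ n * product (nonzeroOr1 ∘ E.to)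
          ≈⟨ *-congʳ product-xIfNonzero ⟨
        product (xIfNonzero ∘ E.to) * product (nonzeroOr1 ∘ E.to)
          ≈⟨ ∑-distrib-+ (xIfNonzero ∘ E.to) (nonzeroOr1 ∘ E.to) ⟨
        product (λ i → xIfNonzero (E.to i) * nonzeroOr1 (E.to i))
          ≈⟨ sum-cong-≋ (nonzeroOr1-* ∘ E.to) ⟨
        product (λ i → nonzeroOr1 (x * E.to i))
          ≈⟨ sum-cong-≋ (λ i → nonzeroOr1-cong (E.inverseˡ {x = x * E.to i} ≡.refl)) ⟨
        product (λ i → nonzeroOr1 (E.to (E.from (x * E.to i))))
          ≈⟨ sum-permute (nonzeroOr1 ∘ E.to) x*-permutation ⟨
        product (nonzeroOr1 ∘ E.to)
          ∎)

    x^[1+n]≈x : ∀ x → x ^ suc n ≈ x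
    x^[1+n]≈x x with x ≟ 0#
    ... | yes x≈0 = trans (^-congˡ (suc n) x≈0) (trans (zeroˡ _) (sym x≈0))
    ... | no  x≉0 = trans (*-congˡ (x^n≈1 x x≉0)) (*-identityʳ x)

  x^q≈x : ∀ {q} → Inverse (≡.setoid (Fin q)) setoid → ∀ x → x ^ q ≈ x
  x^q≈x {zero}  enum x with () ← Inverse.from enum x
  x^q≈x {suc n} enum   = x^[1+n]≈x enum

  N₀≢0 : N₀ ≢ 0
  N₀≢0 N₀≡0 = 1≉0 (begin
    1#                      ≈⟨ E.inverseˡ ≡.refl ⟨
    E.to (E.from 1#)        ≡⟨ ≡.cong E.to (Fin1-irrelevant (E.from 1#) (E.from 0#)) ⟩
    E.to (E.from 0#)        ≈⟨ E.inverseˡ ≡.refl ⟩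
    0#                      ∎)
    where
    module E = Inverse (≡.subst (λ k → Inverse (≡.setoid (Fin (p ℕ.^ k))) setoid) N₀≡0 card)
    Fin1-irrelevant : ∀ (i j : Fin 1) → i ≡ j
    Fin1-irrelevant Fin.zero Fin.zero = ≡.refl

module ResidueField {c ℓ} (R : CommutativeRing c ℓ) {p N₀ : ℕ} (p-prime : Prime p)
  (FF : Field.IsFiniteField R p N₀) (α₀ : CommutativeRing.Carrier R)
  (Trα₀≈1 : CommutativeRing._≈_ R (Field.Ops.Tr R p N₀ α₀ α₀) (CommutativeRing.1# R)) where
  open CommutativeRing R
  open Field R using (sumTo) renaming (_^_ to _^ᶠ_)
  open Field.Ops R p N₀ α₀
  open RingSums R
  open Characteristic R p-prime (Field.IsFiniteField.char-p FF)
  open FiniteField R FF using (x^q≈x; N₀≢0)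
  open import Algebra.Properties.Semiring.Exp semiring using (_^_; ^-congˡ; ^-assocʳ)
  open import Algebra.Properties.CommutativeSemiring.Exp commutativeSemiring using (^-distrib-*)
  open import Relation.Binary.Reasoning.Setoid setoid

  ^ᶠ≈^ : ∀ x n → x ^ᶠ n ≈ x ^ n
  ^ᶠ≈^ x zero    = refl
  ^ᶠ≈^ x (suc n) = *-congˡ (^ᶠ≈^ x n)

  frob≈^ : ∀ i x → frob i x ≈ x ^ (p ℕ.^ i)
  frob≈^ i x = ^ᶠ≈^ x (p ℕ.^ i)

  frob-cong : ∀ i {x y} → x ≈ y → frob i x ≈ frob i y
  frob-cong i {x} {y} x≈y = trans (frob≈^ i x) (trans (^-congˡ (p ℕ.^ i) x≈y) (sym (frob≈^ i y)))

  frob-+ : ∀ i x y → frob i (x + y) ≈ frob i x + frob i y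
  frob-+ i x y = trans (frob≈^ i _) (trans (^p^i-+ i x y) (sym (+-cong (frob≈^ i x) (frob≈^ i y))))

  frob-‿ : ∀ i x → frob i (- x) ≈ - frob i x
  frob-‿ i x = trans (frob≈^ i _) (trans (^p^i-‿ i x) (-‿cong (sym (frob≈^ i x))))

  frob-zero : ∀ i → frob i 0# ≈ 0#
  frob-zero i = trans (frob≈^ i 0#) (0^p^i≈0 i)

  frob-* : ∀ i x y → frob i (x * y) ≈ frob i x * frob i y
  frob-* i x y = trans (frob≈^ i _) (trans (^-distrib-* x y (p ℕ.^ i)) (sym (*-cong (frob≈^ i x) (frob≈^ i y))))

  frob-identity : ∀ x → frob 0 x ≈ x
  frob-identity = *-identityʳ

  frob-frob : ∀ i j x → frob i (frob j x) ≈ frob (j ℕ.+ i) x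
  frob-frob i j x = begin
    frob i (frob j x)                    ≈⟨ frob≈^ i (frob j x) ⟩
    frob j x ^ (p ℕ.^ i)                 ≈⟨ ^-congˡ (p ℕ.^ i) (frob≈^ j x) ⟩
    (x ^ (p ℕ.^ j)) ^ (p ℕ.^ i)          ≈⟨ ^-assocʳ x (p ℕ.^ j) (p ℕ.^ i) ⟩
    x ^ (p ℕ.^ j ℕ.* p ℕ.^ i)            ≡⟨ ≡.cong (x ^_) (ℕ.^-distribˡ-+-* p j i) ⟨
    x ^ (p ℕ.^ (j ℕ.+ i))                ≈⟨ frob≈^ (j ℕ.+ i) x ⟨
    frob (j ℕ.+ i) x                     ∎

  frob-suc : ∀ j x → frob 1 (frob j x) ≈ frob (suc j) x
  frob-suc j x = trans (frob-frob 1 j x) (reflexive (≡.cong (λ k → frob k x) (ℕ.+-comm j 1)))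

  frob-N₀ : ∀ x → frob N₀ x ≈ x
  frob-N₀ x = trans (frob≈^ N₀ x) (x^q≈x (Field.IsFiniteField.card FF) x)

  frobInv-identity : ∀ x → frobInv 0 x ≈ x
  frobInv-identity x = trans (reflexive (≡.cong (λ k → frob k x) (ℕ.*-zeroʳ (N₀ ℕ.∸ 1)))) (frob-identity x)

  frob-frobInv-suc : ∀ m x → frob 1 (frobInv (suc m) x) ≈ frobInv m x
  frob-frobInv-suc m x = begin
    frob 1 (frob (k ℕ.* suc m) x)   ≈⟨ frob-frob 1 (k ℕ.* suc m) x ⟩
    frob (k ℕ.* suc m ℕ.+ 1) x      ≡⟨ ≡.cong (λ z → frob z x) exponent ⟩
    frob (N₀ ℕ.+ k ℕ.* m) x         ≈⟨ frob-frob (k ℕ.* m) N₀ x ⟨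
    frob (k ℕ.* m) (frob N₀ x)      ≈⟨ frob-cong (k ℕ.* m) (frob-N₀ x) ⟩
    frob (k ℕ.* m) x                ∎
    where
    k = N₀ ℕ.∸ 1
    exponent : k ℕ.* suc m ℕ.+ 1 ≡ N₀ ℕ.+ k ℕ.* m
    exponent = ≡.trans (≡.cong (ℕ._+ 1) (ℕ.*-suc k m))
               (≡.trans (ℕ.+-comm (k ℕ.+ k ℕ.* m) 1)
                        (≡.cong (ℕ._+ k ℕ.* m) (ℕ.suc-pred N₀ {{ℕ.≢-nonZero N₀≢0}})))

  frobInv-cong : ∀ m {x y} → x ≈ y → frobInv m x ≈ frobInv m y
  frobInv-cong m = frob-cong ((N₀ ℕ.∸ 1) ℕ.* m)

  frobInv-+ : ∀ m x y → frobInv m (x + y) ≈ frobInv m x + frobInv m y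
  frobInv-+ m = frob-+ ((N₀ ℕ.∸ 1) ℕ.* m)

  frobInv-zero : ∀ m → frobInv m 0# ≈ 0#
  frobInv-zero m = frob-zero ((N₀ ℕ.∸ 1) ℕ.* m)

  frob-sumTo : ∀ i n f → frob i (sumTo n f) ≈ sumTo n (λ j → frob i (f j))
  frob-sumTo i zero    f = frob-zero i
  frob-sumTo i (suc n) f = trans (frob-+ i _ _) (+-congʳ (frob-sumTo i n f))

  Tr-cong : ∀ {x y} → x ≈ y → Tr x ≈ Tr y
  Tr-cong x≈y = sumTo-cong N₀ (λ i → frob-cong i x≈y)

  Tr-+ : ∀ x y → Tr (x + y) ≈ Tr x + Tr y
  Tr-+ x y = trans (sumTo-cong N₀ (λ i → frob-+ i x y)) (sumTo-+ N₀ _ _)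

  Rconst-cong : ∀ {x y} → x ≈ y → Rconst x ≈ Rconst y
  Rconst-cong x≈y = sumTo-cong N₀ (λ i → sumTo-cong i (λ j → *-congˡ (frob-cong i x≈y)))

  Rconst-+ : ∀ x y → Rconst (x + y) ≈ Rconst x + Rconst y
  Rconst-+ x y = trans (sumTo-cong N₀ inner) (sumTo-+ N₀ _ _)
    where
    inner : ∀ i → sumTo i (λ j → frob j α₀ * frob i (x + y))
                ≈ sumTo i (λ j → frob j α₀ * frob i x) + sumTo i (λ j → frob j α₀ * frob i y)
    inner i = trans (sumTo-cong i (λ j → trans (*-congˡ (frob-+ i x y)) (distribˡ _ _ _))) (sumTo-+ i _ _)

  partialTrace : ℕ → Carrier
  partialTrace i = sumTo i (λ j → frob j α₀)

  frob-partialTrace : ∀ i → frob 1 (partialTrace i) ≈ partialTrace (suc i) - α₀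
  frob-partialTrace i = x≈z//y _ α₀ (partialTrace (suc i)) (begin
    frob 1 (partialTrace i) + α₀                   ≈⟨ +-comm _ α₀ ⟩
    α₀ + frob 1 (partialTrace i)                   ≈⟨ +-congʳ (frob-identity α₀) ⟨
    frob 0 α₀ + frob 1 (partialTrace i)            ≈⟨ +-congˡ (frob-sumTo 1 i _) ⟩
    frob 0 α₀ + sumTo i (λ j → frob 1 (frob j α₀)) ≈⟨ +-congˡ (sumTo-cong i (λ j → frob-suc j α₀)) ⟩
    frob 0 α₀ + sumTo i (λ j → frob (suc j) α₀)    ≈⟨ sumTo-suc i (λ j → frob j α₀) ⟨
    partialTrace (suc i)                           ∎)
    where open import Algebra.Properties.Group +-group using (x≈z//y)

  Tr-shift : ∀ y → sumTo N₀ (λ i → frob (suc i) y) ≈ Tr y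
  Tr-shift y = ∙-cancelʳ y _ _ (begin
    sumTo N₀ (λ i → frob (suc i) y) + y          ≈⟨ +-comm _ y ⟩
    y + sumTo N₀ (λ i → frob (suc i) y)          ≈⟨ +-congʳ (frob-identity y) ⟨
    frob 0 y + sumTo N₀ (λ i → frob (suc i) y)   ≈⟨ sumTo-suc N₀ (λ i → frob i y) ⟨
    Tr y + frob N₀ y                             ≈⟨ +-congˡ (frob-N₀ y) ⟩
    Tr y + y                                     ∎)
    where open import Algebra.Properties.Group +-group using (∙-cancelʳ)

  -- Rconst y is the sum of the terms g i = partialTrace i * σⁱ y, and σ shifts g i to g (i + 1)
  -- up to α₀ σⁱ⁺¹ y; the boundary term g N₀ is y because partialTrace N₀ = Tr α₀ = 1.
  frob-Rconst : ∀ y → frob 1 (Rconst y) ≈ (Rconst y + y) - α₀ * Tr y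
  frob-Rconst y = begin
    frob 1 (Rconst y)                                  ≈⟨ frob-cong 1 Rconst≈Σg ⟩
    frob 1 (sumTo N₀ g)                                ≈⟨ frob-sumTo 1 N₀ g ⟩
    sumTo N₀ (λ i → frob 1 (g i))                      ≈⟨ sumTo-cong N₀ frob-g ⟩
    sumTo N₀ (λ i → g (suc i) - α₀ * frob (suc i) y)   ≈⟨ sumTo-+ N₀ _ _ ⟩
    sumTo N₀ (λ i → g (suc i)) + sumTo N₀ (λ i → - (α₀ * frob (suc i) y))
                                                       ≈⟨ +-cong Σg∘suc≈Rconst+y (sumTo-‿ N₀ _) ⟩
    (Rconst y + y) - sumTo N₀ (λ i → α₀ * frob (suc i) y)
                                                       ≈⟨ +-congˡ (-‿cong (trans (sumTo-*ˡ N₀ _ α₀) (*-congˡ (Tr-shift y)))) ⟩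
    (Rconst y + y) - α₀ * Tr y                         ∎
    where
    open import Algebra.Properties.Ring ring using (-‿distribˡ-*)
    g : ℕ → Carrier
    g i = partialTrace i * frob i y
    Rconst≈Σg : Rconst y ≈ sumTo N₀ g
    Rconst≈Σg = sumTo-cong N₀ (λ i → sumTo-*ʳ i (λ j → frob j α₀) (frob i y))
    frob-g : ∀ i → frob 1 (g i) ≈ g (suc i) - α₀ * frob (suc i) y
    frob-g i = begin
      frob 1 (g i)                                  ≈⟨ frob-* 1 (partialTrace i) (frob i y) ⟩
      frob 1 (partialTrace i) * frob 1 (frob i y)   ≈⟨ *-cong (frob-partialTrace i) (frob-suc i y) ⟩
      (partialTrace (suc i) - α₀) * frob (suc i) y  ≈⟨ distribʳ _ _ _ ⟩
      g (suc i) + - α₀ * frob (suc i) y             ≈⟨ +-congˡ (-‿distribˡ-* α₀ _) ⟨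
      g (suc i) - α₀ * frob (suc i) y               ∎
    Σg∘suc≈Rconst+y : sumTo N₀ (λ i → g (suc i)) ≈ Rconst y + y
    Σg∘suc≈Rconst+y = begin
      sumTo N₀ (λ i → g (suc i))         ≈⟨ +-identityˡ _ ⟨
      0# + sumTo N₀ (λ i → g (suc i))    ≈⟨ +-congʳ (zeroˡ (frob 0 y)) ⟨
      g 0 + sumTo N₀ (λ i → g (suc i))   ≈⟨ sumTo-suc N₀ g ⟨
      sumTo N₀ g + g N₀                  ≈⟨ +-cong (sym Rconst≈Σg) (trans (*-cong Trα₀≈1 (frob-N₀ y)) (*-identityˡ y)) ⟩
      Rconst y + y                       ∎

  constantTerm-decomposition : ∀ y → α₀ * Tr y + (frob 1 (Rconst y) - Rconst y) ≈ y
  constantTerm-decomposition y = begin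
    A + (frob 1 Ry - Ry)             ≈⟨ +-congˡ (+-congʳ (frob-Rconst y)) ⟩
    A + (((Ry + y) - A) - Ry)        ≈⟨ +-congˡ (+-congʳ (+-assoc Ry y (- A))) ⟩
    A + ((Ry + (y - A)) - Ry)        ≈⟨ +-congˡ (xyx⁻¹≈y Ry (y - A)) ⟩
    A + (y - A)                      ≈⟨ +-assoc A y (- A) ⟨
    (A + y) - A                      ≈⟨ xyx⁻¹≈y A y ⟩
    y                                ∎
    where
    open import Algebra.Properties.AbelianGroup +-abelianGroup using (xyx⁻¹≈y)
    A  = α₀ * Tr y
    Ry = Rconst y

module LocalOperators {c ℓ} (R : CommutativeRing c ℓ) {p N₀ : ℕ} (p-prime : Prime p)
  (FF : Field.IsFiniteField R p N₀) (α₀ : CommutativeRing.Carrier R) {n : ℕ} where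
  open CommutativeRing R
  open Field.Ops R p N₀ α₀
  open FiniteField R FF using (_≟_)
  open PowerBounds p (ℕ.nonTrivial⇒n>1 p {{prime⇒nonTrivial p-prime}})
  open import Algebra.Properties.Group +-group using (identityʳ-unique; x≈y⇒x∙y⁻¹≈ε; x∙y⁻¹≈ε⇒x≈y)

  Local : (𝒦 n → Series n) → Set (c ⊔ ℓ)
  Local T = ∀ b b′ c → (∀ {a} → a ⇝ c → coef b a ≈ coef b′ a) → T b c ≈ T b′ c

  Additive : (𝒦 n → Series n) → Set (c ⊔ ℓ)
  Additive T = ∀ b b′ b″ → coef b″ ≋ (coef b ⊕ coef b′) → T b″ ≋ (T b ⊕ T b′)

  coef-outside : ∀ (b : 𝒦 n) {a} → ¬ Above (bnd b) a → coef b a ≈ 0#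
  coef-outside b {a} a∉A with coef b a ≟ 0#
  ... | yes ba≈0 = ba≈0
  ... | no  ba≉0 = ⊥-elim (a∉A (supp b a ba≉0))

  0𝒦 : Bounds n → 𝒦 n
  0𝒦 A = record { coef = λ _ → 0# ; bnd = A ; supp = λ _ 0≉0 → ⊥-elim (0≉0 refl) }

  additive-0𝒦 : ∀ {T} → Additive T → ∀ A c → T (0𝒦 A) c ≈ 0#
  additive-0𝒦 T-additive A c =
    identityʳ-unique _ _ (sym (T-additive (0𝒦 A) (0𝒦 A) (0𝒦 A) (λ _ → sym (+-identityʳ 0#)) c))

  local⇒well-defined : ∀ {T} → Local T → ∀ b b′ → coef b ≋ coef b′ → T b ≋ T b′
  local⇒well-defined T-local b b′ b≈b′ c = T-local b b′ c (λ {a} _ → b≈b′ a)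

  local∧additive⇒InK : ∀ {T} → Local T → Additive T → ∀ b → InK (T b)
  local∧additive⇒InK {T} T-local T-additive b = supportBounds (bnd b) , inSupport
    where
    inSupport : ∀ c → ¬ (T b c ≈ 0#) → Above (supportBounds (bnd b)) c
    inSupport c Tbc≉0 with above? (supportBounds (bnd b)) c
    ... | yes c∈A = c∈A
    ... | no  c∉A = ⊥-elim (Tbc≉0 (trans
          (T-local b (0𝒦 (bnd b)) c (λ a⇝c → coef-outside b (c∉A ∘ above-supportBounds (bnd b) a⇝c)))
          (additive-0𝒦 T-additive (bnd b) c)))

  local⇒continuous : ∀ {T} → Local T → ∀ b₀ B → ∃ λ B′ →
                     ∀ b → InU B′ (coef b ⊖ coef b₀) → InU B (T b ⊖ T b₀)
  local⇒continuous T-local b₀ B = continuityBounds B , λ b b≈b₀ c c<B →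
    x≈y⇒x∙y⁻¹≈ε (T-local b b₀ c (λ {a} a⇝c → x∙y⁻¹≈ε⇒x≈y _ _ (b≈b₀ a (below-continuityBounds B a⇝c c<B))))

module Operators {c ℓ} (R : CommutativeRing c ℓ) {p N₀ : ℕ} (p-prime : Prime p)
  (FF : Field.IsFiniteField R p N₀) (α₀ : CommutativeRing.Carrier R)
  (Trα₀≈1 : CommutativeRing._≈_ R (Field.Ops.Tr R p N₀ α₀ α₀) (CommutativeRing.1# R)) {n : ℕ} where
  open CommutativeRing R
  open Field R using (sumTo)
  open Field.Ops R p N₀ α₀
  open RingSums R
  open LocalOperators R p-prime FF α₀
  open ResidueField R p-prime FF α₀ Trα₀≈1
  open PowerBounds p (ℕ.nonTrivial⇒n>1 p {{prime⇒nonTrivial p-prime}})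
  open import Relation.Binary.Reasoning.Setoid setoid
  open import Algebra.Properties.Group +-group using (ε⁻¹≈ε)

  negTerm : Series n → Exp n → ℕ → Carrier
  negTerm f c m = frobInv m (f (scaleExp (p ℕ.^ m) c))

  posTerm : Series n → Exp n → ℕ → Carrier
  posTerm f c i = if allDiv (p ℕ.^ i) c then frob i (f (divExp (p ℕ.^ i) c)) else 0#

  𝓢-pos : ∀ b (c : Exp n) → lexSign c ≡ pos → 𝓢 b c ≡ 0#
  𝓢-pos b c c>0 with lexSign c | c>0
  ... | pos | _ = ≡.refl

  𝓢-zer : ∀ b (c : Exp n) → lexSign c ≡ zer → 𝓢 b c ≡ α₀ * Tr (coef b c)
  𝓢-zer b c c≡0 with lexSign c | c≡0
  ... | zer | _ = ≡.refl

  𝓢-neg-p∣ : ∀ b (c : Exp n) → lexSign c ≡ neg → allDiv p c ≡ true → 𝓢 b c ≡ 0#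
  𝓢-neg-p∣ b c c<0 p∣c with lexSign c | c<0
  ... | neg | _ rewrite p∣c = ≡.refl

  𝓢-neg-p∤ : ∀ b (c : Exp n) → lexSign c ≡ neg → allDiv p c ≡ false →
             𝓢 b c ≡ sumTo (suc (cutNeg (bnd b) c)) (negTerm (coef b) c)
  𝓢-neg-p∤ b c c<0 p∤c with lexSign c | c<0
  ... | neg | _ rewrite p∤c = ≡.refl

  𝓡-pos : ∀ b (c : Exp n) → lexSign c ≡ pos → 𝓡 b c ≡ - sumTo (suc (firstAbs c)) (posTerm (coef b) c)
  𝓡-pos b c c>0 with lexSign c | c>0
  ... | pos | _ = ≡.refl

  𝓡-zer : ∀ b (c : Exp n) → lexSign c ≡ zer → 𝓡 b c ≡ Rconst (coef b c)
  𝓡-zer b c c≡0 with lexSign c | c≡0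
  ... | zer | _ = ≡.refl

  𝓡-neg : ∀ b (c : Exp n) → lexSign c ≡ neg →
          𝓡 b c ≡ sumTo (suc (cutNeg (bnd b) c)) (λ m → negTerm (coef b) c (suc m))
  𝓡-neg b c c<0 with lexSign c | c<0
  ... | neg | _ = ≡.refl

  negTerm-vanishes : ∀ (b : 𝒦 n) c → lexSign c ≡ neg → VanishesFrom (suc (cutNeg (bnd b) c)) (negTerm (coef b) c)
  negTerm-vanishes b c c<0 m cutNeg<m = trans (frobInv-cong m (coef-outside b outside)) (frobInv-zero m)
    where
    outside : ¬ Above (bnd b) (scaleExp (p ℕ.^ m) c)
    outside above = ℕ.<-irrefl ≡.refl (ℕ.<-≤-trans (ℕ.<-≤-trans cutNeg<m (ℕ.<⇒≤ (i<p^i m)))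
                                                    (cutNeg-bound (p ℕ.^ m) {{p^≢0 m}} (bnd b) c c<0 above))

  posTerm-vanishes : ∀ f (c : Exp n) → lexSign c ≡ pos → VanishesFrom (firstAbs c) (posTerm f c)
  posTerm-vanishes f c c>0 i firstAbs≤i with allDiv (p ℕ.^ i) c in p^i∣c
  ... | false = refl
  ... | true  = ⊥-elim (ℕ.<-irrefl ≡.refl (ℕ.<-≤-trans (i<p^i i)
                  (ℕ.≤-trans (allDiv⇒≤firstAbs (p ℕ.^ i) {{p^≢0 i}} c c≢0 p^i∣c) firstAbs≤i)))
    where
    c≢0 : lexSign c ≢ zer
    c≢0 c≡0 with () ← ≡.trans (≡.sym c>0) c≡0

  negTerm-vanishes-suc : ∀ (b : 𝒦 n) c → lexSign c ≡ neg →
                         VanishesFrom (suc (cutNeg (bnd b) c)) (λ m → negTerm (coef b) c (suc m))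
  negTerm-vanishes-suc b c c<0 m k<m = negTerm-vanishes b c c<0 (suc m) (ℕ.m≤n⇒m≤1+n k<m)

  posTerm-local : ∀ {f g} (c : Exp n) → lexSign c ≡ pos → (∀ {a} → a ⇝ c → f a ≈ g a) →
                  ∀ i → posTerm f c i ≈ posTerm g c i
  posTerm-local c c>0 f≈g i with allDiv (p ℕ.^ i) c in p^i∣c
  ... | false = refl
  ... | true  = frob-cong i (f≈g (≡.subst (divExp (p ℕ.^ i) c ⇝_) (scaleExp-divExp (p ℕ.^ i) {{p^≢0 i}} c p^i∣c)
                                          (⇝-pos (≡.trans (lexSign-divExp (p ℕ.^ i) {{p^≢0 i}} c p^i∣c) c>0) i)))

  posTerm-+ : ∀ {f g h} (c : Exp n) → (∀ a → h a ≈ f a + g a) →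
              ∀ i → posTerm h c i ≈ posTerm f c i + posTerm g c i
  posTerm-+ c h≈f+g i with allDiv (p ℕ.^ i) c
  ... | false = sym (+-identityʳ 0#)
  ... | true  = trans (frob-cong i (h≈f+g _)) (frob-+ i _ _)

  𝓢-local : Local 𝓢
  𝓢-local b b′ c b≈b′ with lexSign c in c≶0
  ... | pos = refl
  ... | zer = *-congˡ (Tr-cong (b≈b′ (⇝-zer c≶0)))
  ... | neg with allDiv p c
  ...   | true  = refl
  ...   | false = sumTo-cong-vanishing (negTerm-vanishes b c c≶0) (negTerm-vanishes b′ c c≶0)
                                       (λ m → frobInv-cong m (b≈b′ (⇝-neg c≶0 m)))

  𝓡-local : Local 𝓡
  𝓡-local b b′ c b≈b′ with lexSign c in c≶0
  ... | pos = -‿cong (sumTo-cong (suc (firstAbs c)) (posTerm-local c c≶0 b≈b′))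
  ... | zer = Rconst-cong (b≈b′ (⇝-zer c≶0))
  ... | neg = sumTo-cong-vanishing (negTerm-vanishes-suc b c c≶0) (negTerm-vanishes-suc b′ c c≶0)
                                   (λ m → frobInv-cong (suc m) (b≈b′ (⇝-neg c≶0 (suc m))))

  𝓢-additive : Additive 𝓢
  𝓢-additive b b′ b″ b″≈b+b′ c with lexSign c in c≶0
  ... | pos = sym (+-identityʳ 0#)
  ... | zer = trans (*-congˡ (trans (Tr-cong (b″≈b+b′ c)) (Tr-+ _ _))) (distribˡ α₀ _ _)
  ... | neg with allDiv p c
  ...   | true  = sym (+-identityʳ 0#)
  ...   | false = sumTo-+-vanishing (negTerm-vanishes b c c≶0) (negTerm-vanishes b′ c c≶0)
                                    (negTerm-vanishes b″ c c≶0)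
                                    (λ m → trans (frobInv-cong m (b″≈b+b′ _)) (frobInv-+ m _ _))

  𝓡-additive : Additive 𝓡
  𝓡-additive b b′ b″ b″≈b+b′ c with lexSign c in c≶0
  ... | pos = trans (-‿cong (trans (sumTo-cong L (posTerm-+ c b″≈b+b′)) (sumTo-+ L _ _))) (-‿distrib-+ _ _)
    where L = suc (firstAbs c)
  ... | zer = trans (Rconst-cong (b″≈b+b′ c)) (Rconst-+ _ _)
  ... | neg = sumTo-+-vanishing (negTerm-vanishes-suc b c c≶0) (negTerm-vanishes-suc b′ c c≶0)
                                (negTerm-vanishes-suc b″ c c≶0)
                                (λ m → trans (frobInv-cong (suc m) (b″≈b+b′ _)) (frobInv-+ (suc m) _ _))

  posTerm-0 : ∀ f (c : Exp n) → posTerm f c 0 ≈ f c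
  posTerm-0 f c rewrite allDiv-1 c | divExp-1 c = frob-identity (f c)

  negTerm-0 : ∀ f (c : Exp n) → negTerm f c 0 ≈ f c
  negTerm-0 f c = trans (frobInv-identity _) (reflexive (≡.cong f (scaleExp-1 c)))

  posTerm-shift : ∀ f (a : Exp n) i → frob 1 (posTerm f a i) ≈ posTerm f (scaleExp p a) (suc i)
  posTerm-shift f a i rewrite allDiv-*-scaleExp p (p ℕ.^ i) {{p≢0}} {{p^≢0 i}} a
    with allDiv (p ℕ.^ i) a in p^i∣a
  ... | true  = trans (frob-suc i _) (frob-cong (suc i) (reflexive (≡.cong f
                  (≡.sym (divExp-*-scaleExp p (p ℕ.^ i) {{p≢0}} {{p^≢0 i}} a p^i∣a)))))
  ... | false = frob-zero 1

  negTerm-shift : ∀ f (a : Exp n) m → frob 1 (negTerm f a (suc m)) ≈ negTerm f (scaleExp p a) m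
  negTerm-shift f a m = trans (frob-frobInv-suc m _) (frobInv-cong m (reflexive (≡.cong f
    (≡.trans (≡.cong (λ d → scaleExp d a) (ℕ.*-comm p (p ℕ.^ m))) (≡.sym (scaleExp-scaleExp (p ℕ.^ m) p a))))))

  σ𝓡-pos : ∀ (b : 𝒦 n) c → lexSign c ≡ pos →
           σ𝒦 (𝓡 b) c ≈ - sumTo (suc (firstAbs c)) (λ i → posTerm (coef b) c (suc i))
  σ𝓡-pos b c c>0 with allDiv p c in p∣c
  ... | false = sym (trans (-‿cong (trans (sumTo-cong L p∤c⇒posTerm≈0) (sumTo-0 L))) ε⁻¹≈ε)
    where
    L = suc (firstAbs c)
    p∤c⇒posTerm≈0 : ∀ i → posTerm (coef b) c (suc i) ≈ 0#
    p∤c⇒posTerm≈0 i with allDiv (p ℕ.* p ℕ.^ i) c in p^[1+i]∣c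
    ... | false = refl
    ... | true with () ← ≡.trans (≡.sym (allDiv-*⇒allDiv p (p ℕ.^ i) {{p≢0}} {{p^≢0 i}} c p^[1+i]∣c)) p∣c
  ... | true = begin
    frob 1 (𝓡 b a)                                   ≡⟨ ≡.cong (frob 1) (𝓡-pos b a a>0) ⟩
    frob 1 (- sumTo La (posTerm (coef b) a))          ≈⟨ frob-‿ 1 _ ⟩
    - frob 1 (sumTo La (posTerm (coef b) a))          ≈⟨ -‿cong (frob-sumTo 1 La _) ⟩
    - sumTo La (λ i → frob 1 (posTerm (coef b) a i))  ≈⟨ -‿cong (sumTo-cong-vanishing σa-vanishes c-vanishes σa≈c) ⟩
    - sumTo (suc (firstAbs c)) (λ i → posTerm (coef b) c (suc i)) ∎
    where
    a = divExp p c
    La = suc (firstAbs a)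
    a>0 = ≡.trans (lexSign-divExp p c p∣c) c>0
    σa-vanishes : VanishesFrom La (λ i → frob 1 (posTerm (coef b) a i))
    σa-vanishes i a<i = trans (frob-cong 1 (posTerm-vanishes (coef b) a a>0 i (ℕ.<⇒≤ a<i))) (frob-zero 1)
    c-vanishes : VanishesFrom (suc (firstAbs c)) (λ i → posTerm (coef b) c (suc i))
    c-vanishes i c<i = posTerm-vanishes (coef b) c c>0 (suc i) (ℕ.m≤n⇒m≤1+n (ℕ.<⇒≤ c<i))
    σa≈c : ∀ i → frob 1 (posTerm (coef b) a i) ≈ posTerm (coef b) c (suc i)
    σa≈c i = trans (posTerm-shift (coef b) a i)
                   (reflexive (≡.cong (λ c′ → posTerm (coef b) c′ (suc i)) (scaleExp-divExp p c p∣c)))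

  𝓢+σ𝓡-neg : ∀ (b : 𝒦 n) c → lexSign c ≡ neg →
             𝓢 b c + σ𝒦 (𝓡 b) c ≈ sumTo (suc (cutNeg (bnd b) c)) (negTerm (coef b) c)
  𝓢+σ𝓡-neg b c c<0 with allDiv p c in p∣c
  ... | false = trans (+-identityʳ (𝓢 b c)) (reflexive (𝓢-neg-p∤ b c c<0 p∣c))
  ... | true  = begin
    𝓢 b c + frob 1 (𝓡 b a)
      ≡⟨ ≡.cong₂ (λ x y → x + frob 1 y) (𝓢-neg-p∣ b c c<0 p∣c) (𝓡-neg b a a<0) ⟩
    0# + frob 1 (sumTo L (λ m → negTerm (coef b) a (suc m)))
      ≈⟨ +-identityˡ _ ⟩
    frob 1 (sumTo L (λ m → negTerm (coef b) a (suc m)))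
      ≈⟨ frob-sumTo 1 L _ ⟩
    sumTo L (λ m → frob 1 (negTerm (coef b) a (suc m)))
      ≈⟨ sumTo-cong L (negTerm-shift (coef b) a) ⟩
    sumTo L (negTerm (coef b) (scaleExp p a))
      ≡⟨ ≡.cong₂ (λ k c′ → sumTo (suc k) (negTerm (coef b) c′)) (cutNeg-divExp p (bnd b) c p∣c)
                 (scaleExp-divExp p c p∣c) ⟩
    sumTo (suc (cutNeg (bnd b) c)) (negTerm (coef b) c)
      ∎
    where
    a = divExp p c
    a<0 = ≡.trans (lexSign-divExp p c p∣c) c<0
    L = suc (cutNeg (bnd b) a)

  decomposition-zer : ∀ (b : 𝒦 n) c → lexSign c ≡ zer → 𝓢 b c + (σ𝒦 (𝓡 b) c - 𝓡 b c) ≈ coef b c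
  decomposition-zer b c c≡0 = begin
    𝓢 b c + (σ𝒦 (𝓡 b) c - 𝓡 b c)
      ≡⟨ ≡.cong₂ (λ x y → x + (y - 𝓡 b c)) (𝓢-zer b c c≡0) σ𝓡≡ ⟩
    α₀ * Tr y + (frob 1 (𝓡 b c) - 𝓡 b c)
      ≡⟨ ≡.cong (λ r → α₀ * Tr y + (frob 1 r - r)) (𝓡-zer b c c≡0) ⟩
    α₀ * Tr y + (frob 1 (Rconst y) - Rconst y)
      ≈⟨ constantTerm-decomposition y ⟩
    y
      ∎
    where
    y = coef b c
    σ𝓡≡ : σ𝒦 (𝓡 b) c ≡ frob 1 (𝓡 b c)
    σ𝓡≡ rewrite allDiv-zer p c c≡0 | divExp-zer p c c≡0 = ≡.refl

  decomposition-pos : ∀ (b : 𝒦 n) c → lexSign c ≡ pos → 𝓢 b c + (σ𝒦 (𝓡 b) c - 𝓡 b c) ≈ coef b c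
  decomposition-pos b c c>0 = begin
    𝓢 b c + (σ𝒦 (𝓡 b) c - 𝓡 b c)
      ≈⟨ +-cong (reflexive (𝓢-pos b c c>0)) (+-cong (σ𝓡-pos b c c>0) (-‿cong (reflexive (𝓡-pos b c c>0)))) ⟩
    0# + (- sumTo L (f ∘ suc) - - sumTo L f)
      ≈⟨ trans (+-identityˡ _) ([-x]-[-y]≈y-x _ _) ⟩
    sumTo L f - sumTo L (f ∘ suc)
      ≈⟨ sumTo-telescope L f ⟩
    f 0 - f L
      ≈⟨ +-cong (posTerm-0 (coef b) c) (-‿cong (posTerm-vanishes (coef b) c c>0 L (ℕ.n≤1+n _))) ⟩
    coef b c - 0#
      ≈⟨ x-0≈x (coef b c) ⟩
    coef b c
      ∎
    where
    f = posTerm (coef b) c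
    L = suc (firstAbs c)

  decomposition-neg : ∀ (b : 𝒦 n) c → lexSign c ≡ neg → 𝓢 b c + (σ𝒦 (𝓡 b) c - 𝓡 b c) ≈ coef b c
  decomposition-neg b c c<0 = begin
    𝓢 b c + (σ𝒦 (𝓡 b) c - 𝓡 b c)
      ≈⟨ +-assoc _ _ _ ⟨
    (𝓢 b c + σ𝒦 (𝓡 b) c) - 𝓡 b c
      ≈⟨ +-cong (𝓢+σ𝓡-neg b c c<0) (-‿cong (reflexive (𝓡-neg b c c<0))) ⟩
    sumTo L f - sumTo L (f ∘ suc)
      ≈⟨ sumTo-telescope L f ⟩
    f 0 - f L
      ≈⟨ +-cong (negTerm-0 (coef b) c) (-‿cong (negTerm-vanishes b c c<0 L ℕ.≤-refl)) ⟩
    coef b c - 0#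
      ≈⟨ x-0≈x (coef b c) ⟩
    coef b c
      ∎
    where
    f = negTerm (coef b) c
    L = suc (cutNeg (bnd b) c)

  decomposition : ∀ (b : 𝒦 n) → coef b ≋ (𝓢 b ⊕ (σ𝒦 (𝓡 b) ⊖ 𝓡 b))
  decomposition b c = sym (bySign (lexSign c) ≡.refl)
    where
    bySign : ∀ s → lexSign c ≡ s → 𝓢 b c + (σ𝒦 (𝓡 b) c - 𝓡 b c) ≈ coef b c
    bySign pos = decomposition-pos b c
    bySign zer = decomposition-zer b c
    bySign neg = decomposition-neg b c

proposition3p1 :
  ∀ {c ℓ} (R : CommutativeRing c ℓ) (p N₀ N : ℕ) →
  Prime p → 2 < p →
  Field.IsFiniteField R p N₀ →
  (α₀ : CommutativeRing.Carrier R) →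
  CommutativeRing._≈_ R (Field.Ops.Tr R p N₀ α₀ α₀) (CommutativeRing.1# R) →
  let open CommutativeRing R
      open Field.Ops R p N₀ α₀
  in
  -- 𝓢 and 𝓡 map 𝒦 into 𝒦
  (∀ (b : 𝒦 N) → InK (𝓢 b)) × (∀ (b : 𝒦 N) → InK (𝓡 b)) ×
  -- they are well defined on series (independent of the chosen support bounds)
  (∀ (b b′ : 𝒦 N) → coef b ≋ coef b′ → 𝓢 b ≋ 𝓢 b′) ×
  (∀ (b b′ : 𝒦 N) → coef b ≋ coef b′ → 𝓡 b ≋ 𝓡 b′) ×
  -- additive, hence 𝔽_p-linear
  (∀ (b b′ b″ : 𝒦 N) → coef b″ ≋ (coef b ⊕ coef b′) → 𝓢 b″ ≋ (𝓢 b ⊕ 𝓢 b′)) ×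
  (∀ (b b′ b″ : 𝒦 N) → coef b″ ≋ (coef b ⊕ coef b′) → 𝓡 b″ ≋ (𝓡 b ⊕ 𝓡 b′)) ×
  -- 𝒫-continuous
  (∀ (b₀ : 𝒦 N) (B : Bounds N) → ∃ λ (B′ : Bounds N) →
     ∀ (b : 𝒦 N) → InU B′ (coef b ⊖ coef b₀) → InU B (𝓢 b ⊖ 𝓢 b₀)) ×
  (∀ (b₀ : 𝒦 N) (B : Bounds N) → ∃ λ (B′ : Bounds N) →
     ∀ (b : 𝒦 N) → InU B′ (coef b ⊖ coef b₀) → InU B (𝓡 b ⊖ 𝓡 b₀)) ×
  -- b = 𝓢(b) + (σ - id) 𝓡(b)
  (∀ (b : 𝒦 N) → coef b ≋ (𝓢 b ⊕ (σ𝒦 (𝓡 b) ⊖ 𝓡 b)))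
proposition3p1 R p N₀ N p-prime _ FF α₀ Trα₀≈1 =
  local∧additive⇒InK 𝓢-local 𝓢-additive , local∧additive⇒InK 𝓡-local 𝓡-additive ,
  local⇒well-defined 𝓢-local , local⇒well-defined 𝓡-local ,
  𝓢-additive , 𝓡-additive ,
  local⇒continuous 𝓢-local , local⇒continuous 𝓡-local ,
  decomposition
  where
  -- The hypothesis 2 < p is unused: the argument works for every prime p.
  open LocalOperators R p-prime FF α₀
  open Operators R p-prime FF α₀ Trα₀≈1
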